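{- Let $t,k,v,\lambda$ be integers with $0\le t\le k\le v$ and $\lambda\ge1$, and let $\mathcal{D}$ be a $t$-$(v,k,\lambda)$ design with point set $[v]$ and block set $\mathcal{B}$. Let $\lambda_0=|\mathcal{B}|$. (1) If $t\ge1$ and $\mathcal{B}$ is an independent set in $\Gamma_{v,k}$, then $$\sum_{i=0}^k i\,a_i(\mathcal{D})=\frac{\lambda_0k(v-k)}{2}.$$ (2) If $\mathcal{D}$ is a Steiner system $S(2,3,v)$, then $$a_0(\mathcal{D})+a_3(\mathcal{D})=\sum_{\{B,C\}\in\binom{\mathcal{B}}{2}}I(B,C)-\frac{v(v-1)(v-3)}{12},$$ where $I(B,C)=|N^-(B)\cap N^-(C)|$.
   Context: $[v]=\{0,\dots,v-1\}$. A $t$-$(v,k,\lambda)$ design is a pair $([v],\mathcal{B})$ with $\mathcal{B}\subseteq\binom{[v]}{k}$ such that every $t$-subset of $[v]$ lies in exactly $\lambda$ blocks. An $S(2,3,v)$ is a $2$-$(v,3,1)$ design. Welter's game $\Gamma_{v,k}$ is the digraph on $\binom{[v]}{k}$ with edges $(P,(P\setminus\{p\})\cup\{q\})$ for $q<p$, $p\in P$, $q\notin P$. Let $N^+(P)$ and $N^-(P)$ denote the out- and in-neighbor sets of $P$ in $\Gamma_{v,k}$. A set $\mathcal{B}$ is independent if there is no edge $(B,C)$ with $B,C\in\mathcal{B}$. Define $$a_i(\mathcal{D})=\Big|\Big\{P\in\tbinom{[v]}{k}\setminus\mathcal{B}:|N^+(P)\cap\mathcal{B}|=i\Big\}\Big|.$$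 $\binom{\mathcal{B}}{2}$ denotes the set of unordered pairs of distinct blocks. -}

module Defs where

open import Data.Nat using (ℕ; zero; suc; _+_; _*_; _∸_; _≡ᵇ_; _<ᵇ_)
open import Data.Bool using (Bool; true; false; _∧_; not; if_then_else_)
import Data.Bool.Properties as BoolP
open import Data.Fin using (Fin; toℕ)
open import Data.Fin.Subset using (Subset; inside; outside; ∣_∣; _⊆_)
open import Data.Fin.Subset.Properties using (_⊆?_)
open import Data.Vec using (Vec; []; _∷_; lookup; _[_]≔_)
open import Data.Vec.Properties using (≡-dec)
open import Data.List using (List; []; _∷_; _++_; map; allFin; upTo; filterᵇ)
open import Data.Nat.ListAction using (sum)
open import Data.Bool.ListAction using (any)
open import Data.Product using (_×_; _,_)
open import Relation.Nullary.Decidable using (⌊_⌋)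
open import Relation.Binary.PropositionalEquality using (_≡_)

allSubsets : (v : ℕ) → List (Subset v)
allSubsets zero = [] ∷ []
allSubsets (suc v) = map (outside ∷_) (allSubsets v) ++ map (inside ∷_) (allSubsets v)

count : {A : Set} → (A → Bool) → List A → ℕ
count p [] = 0
count p (x ∷ xs) = if p x then suc (count p xs) else count p xs

-- the k-subsets of [v] (vertex set of Welter's game Γ_{v,k})
kSubsets : (v k : ℕ) → List (Subset v)
kSubsets v k = filterᵇ (λ P → ∣ P ∣ ≡ᵇ k) (allSubsets v)

edge : {v : ℕ} → Subset v → Subset v → Bool
edge {v} P Q =
  any (λ p → any (λ q →
      (toℕ q <ᵇ toℕ p) ∧ lookup P p ∧ not (lookup P q)
      ∧ ⌊ ≡-dec BoolP._≟_ Q ((P [ p ]≔ outside) [ q ]≔ inside) ⌋)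
    (allFin v)) (allFin v)

-- a block set is given by its (boolean) characteristic predicate on subsets of [v]
BlockSet : ℕ → Set
BlockSet v = Subset v → Bool

IsDesign : (t v k lam : ℕ) → BlockSet v → Set
IsDesign t v k lam B =
  ((P : Subset v) → B P ≡ true → ∣ P ∣ ≡ k) ×
  ((T : Subset v) → ∣ T ∣ ≡ t →
     count (λ P → B P ∧ ⌊ T ⊆? P ⌋) (allSubsets v) ≡ lam)

numBlocks : {v : ℕ} → BlockSet v → ℕ
numBlocks {v} B = count B (allSubsets v)

Independent : (v k : ℕ) → BlockSet v → Set
Independent v k B = (P Q : Subset v) → ∣ P ∣ ≡ k → ∣ Q ∣ ≡ k →
  B P ≡ true → B Q ≡ true → edge P Q ≡ false

outBlocks : (v k : ℕ) → BlockSet v → Subset v → ℕ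
outBlocks v k B P = count (λ Q → edge P Q ∧ B Q) (kSubsets v k)

a : (v k : ℕ) → BlockSet v → ℕ → ℕ
a v k B i = count (λ P → not (B P) ∧ (outBlocks v k B P ≡ᵇ i)) (kSubsets v k)

weightedSum : (v k : ℕ) → BlockSet v → ℕ
weightedSum v k B = sum (map (λ i → i * a v k B i) (upTo (suc k)))

I : (v k : ℕ) → Subset v → Subset v → ℕ
I v k X Y = count (λ P → edge P X ∧ edge P Y) (kSubsets v k)

pairs : {A : Set} → List A → List (A × A)
pairs [] = []
pairs (x ∷ xs) = map (x ,_) xs ++ pairs xs

blockList : {v : ℕ} → BlockSet v → List (Subset v)
blockList {v} B = filterᵇ B (allSubsets v)

pairSumI : (v k : ℕ) → BlockSet v → ℕ
pairSumI v k B = sum (map (λ { (X , Y) → I v k X Y }) (pairs (blockList B)))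

module Submission where

-- An edge P → Q is given by a unique move (p , q), q < p, p ∈ P,
--   q ∉ P, Q = P - p + q.  So a k-set Q has one in-neighbour per pair q < p with
--   q ∈ Q, p ∉ Q (in-degree), and the blocks reached from P are counted move by
--   move.  If 𝓑 is independent, for each p ∈ P at most one move (p , q) reaches
--   a block, since two such targets are adjacent; hence |N⁺(P) ∩ 𝓑| ≤ k.
-- * Designs.  Counting flags T ⊆ Q (T a t-set, Q a block) with binomial
--   coefficients gives λ₀ C(k,t) = λ C(v,t) and, for t ≥ 1, a replication number
--   r(x) independent of x.  Then the number c(q,p) of blocks containing q but not
--   p is symmetric, and Σ_{q≠p} c(q,p) = Σ_Q |Q| (v - |Q|) = λ₀ k (v - k).
-- * Part (1).  For independent 𝓑, Σ i·a_i counts the edges from non-blocks into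
--   blocks, which are all edges into blocks, i.e. Σ_{q<p} c(q,p); by symmetry twice
--   this is λ₀ k (v - k).
-- * Part (2).  An S(2,3,v) is independent (adjacent blocks would share a pair).  A
--   non-block with d out-neighbours in 𝓑 has d ≤ 3 and [d=0] + [d=3] + d = 1 + C(d,2);
--   summing, with Σ_P C(d_P,2) = Σ I(B,C), λ₀ = v(v-1)/6 and part (1), gives the formula.

open import Defs
open import Data.Nat using (ℕ; zero; suc; _+_; _*_; _∸_; _≤_; _<_; z≤n; s≤s; _≡ᵇ_; _<ᵇ_; >-nonZero)
open import Data.Nat.Properties
open import Data.Nat.Combinatorics using (_C_; nCk+nC[k+1]≡[n+1]C[k+1]; nC1≡n)
open import Data.Nat.Tactic.RingSolver using (solve-∀)
open import Algebra.Properties.CommutativeSemigroup *-commutativeSemigroup using () renaming (x∙yz≈y∙xz to *-left-comm)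
open import Algebra.Properties.CommutativeSemigroup +-commutativeSemigroup using () renaming (interchange to +-interchange)
open import Data.Bool using (Bool; true; false; _∧_; _∨_; not) renaming (T to True)
import Data.Bool.Properties as BoolP
open import Data.Bool.ListAction using (any; or)
open import Data.Fin using (Fin; toℕ) renaming (zero to fzero; suc to fsuc)
import Data.Fin.Properties as FinP
open import Data.Fin.Subset using (Subset; inside; outside; ∣_∣; ⊤)
open import Data.Fin.Subset.Properties using (_⊆?_; ⊆⊤; ∣⊤∣≡n)
open import Data.Vec using (_∷_; []; lookup; _[_]≔_)
open import Data.Vec.Properties using (≡-dec; tabulate∘lookup; tabulate-cong; lookup∘update; lookup∘update′; lookup-replicate; ∷-injectiveʳ; []=⇒lookup; lookup⇒[]=)
open import Data.List using (List; []; _∷_; _++_; map; allFin; upTo; filterᵇ)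
import Data.List.Properties as ListP
open import Data.Nat.ListAction using (sum)
open import Data.Product using (_×_; _,_; Σ; proj₁; proj₂)
open import Data.Empty using (⊥-elim)
open import Data.Unit using (tt)
open import Relation.Nullary using (¬_; yes; no; Dec)
open import Relation.Nullary.Decidable using (⌊_⌋)
open import Relation.Binary.Definitions using (tri<; tri≈; tri>)
open import Relation.Binary.PropositionalEquality
open import Function using (_∘_)
open ≡-Reasoning

⟦_⟧ : Bool → ℕ
⟦ true ⟧ = 1
⟦ false ⟧ = 0

∑ : {A : Set} → List A → (A → ℕ) → ℕ
∑ xs f = sum (map f xs)

∑-++ : {A : Set} (xs ys : List A) (f : A → ℕ) → ∑ (xs ++ ys) f ≡ ∑ xs f + ∑ ys f
∑-++ [] ys f = refl
∑-++ (x ∷ xs) ys f = trans (cong (f x +_) (∑-++ xs ys f)) (sym (+-assoc (f x) _ _))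

∑-map : {A C : Set} (g : A → C) (xs : List A) (f : C → ℕ) → ∑ (map g xs) f ≡ ∑ xs (f ∘ g)
∑-map g [] f = refl
∑-map g (x ∷ xs) f = cong (f (g x) +_) (∑-map g xs f)

∑-cong : {A : Set} (xs : List A) {f g : A → ℕ} → (∀ x → f x ≡ g x) → ∑ xs f ≡ ∑ xs g
∑-cong [] e = refl
∑-cong (x ∷ xs) e = cong₂ _+_ (e x) (∑-cong xs e)

∑-mono : {A : Set} (xs : List A) {f g : A → ℕ} → (∀ x → f x ≤ g x) → ∑ xs f ≤ ∑ xs g
∑-mono [] e = z≤n
∑-mono (x ∷ xs) e = +-mono-≤ (e x) (∑-mono xs e)

∑-zero : {A : Set} (xs : List A) (f : A → ℕ) → (∀ x → f x ≡ 0) → ∑ xs f ≡ 0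
∑-zero [] f e = refl
∑-zero (x ∷ xs) f e = trans (cong (_+ ∑ xs f) (e x)) (∑-zero xs f e)

∑-+ : {A : Set} (xs : List A) (f g : A → ℕ) → ∑ xs (λ x → f x + g x) ≡ ∑ xs f + ∑ xs g
∑-+ [] f g = refl
∑-+ (x ∷ xs) f g = trans (cong (f x + g x +_) (∑-+ xs f g)) (+-interchange (f x) (g x) (∑ xs f) (∑ xs g))

∑-*ˡ : {A : Set} (xs : List A) (c : ℕ) (f : A → ℕ) → ∑ xs (λ x → c * f x) ≡ c * ∑ xs f
∑-*ˡ [] c f = sym (*-zeroʳ c)
∑-*ˡ (x ∷ xs) c f = trans (cong (c * f x +_) (∑-*ˡ xs c f)) (sym (*-distribˡ-+ c (f x) (∑ xs f)))

∑-swap : {A C : Set} (xs : List A) (ys : List C) (f : A → C → ℕ) →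
  ∑ xs (λ x → ∑ ys (f x)) ≡ ∑ ys (λ y → ∑ xs (λ x → f x y))
∑-swap [] ys f = sym (∑-zero ys _ (λ _ → refl))
∑-swap (x ∷ xs) ys f =
  trans (cong (∑ ys (f x) +_) (∑-swap xs ys f)) (sym (∑-+ ys (f x) (λ y → ∑ xs (λ x → f x y))))

count≡∑ : {A : Set} (p : A → Bool) (xs : List A) → count p xs ≡ ∑ xs (λ x → ⟦ p x ⟧)
count≡∑ p [] = refl
count≡∑ p (x ∷ xs) with p x
... | true = cong suc (count≡∑ p xs)
... | false = count≡∑ p xs

∑-filter : {A : Set} (h : A → Bool) (xs : List A) (f : A → ℕ) →
  ∑ (filterᵇ h xs) f ≡ ∑ xs (λ x → ⟦ h x ⟧ * f x)
∑-filter h [] f = refl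
∑-filter h (x ∷ xs) f with h x
... | true = cong₂ _+_ (sym (+-identityʳ (f x))) (∑-filter h xs f)
... | false = ∑-filter h xs f

allFin-suc : (n : ℕ) → allFin (suc n) ≡ fzero ∷ map fsuc (allFin n)
allFin-suc n = cong (fzero ∷_) (sym (ListP.map-tabulate {n = n} (λ i → i) fsuc))

∑-allFin-suc : (n : ℕ) (f : Fin (suc n) → ℕ) → ∑ (allFin (suc n)) f ≡ f fzero + ∑ (allFin n) (f ∘ fsuc)
∑-allFin-suc n f = begin
  ∑ (allFin (suc n)) f                  ≡⟨ cong (λ l → ∑ l f) (allFin-suc n) ⟩
  f fzero + ∑ (map fsuc (allFin n)) f   ≡⟨ cong (f fzero +_) (∑-map fsuc (allFin n) f) ⟩
  f fzero + ∑ (allFin n) (f ∘ fsuc)     ∎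

∑-allSubsets-suc : (v : ℕ) (f : Subset (suc v) → ℕ) →
  ∑ (allSubsets (suc v)) f ≡ ∑ (allSubsets v) (f ∘ (outside ∷_)) + ∑ (allSubsets v) (f ∘ (inside ∷_))
∑-allSubsets-suc v f = trans (∑-++ (map (outside ∷_) (allSubsets v)) (map (inside ∷_) (allSubsets v)) f)
  (cong₂ _+_ (∑-map (outside ∷_) (allSubsets v) f) (∑-map (inside ∷_) (allSubsets v) f))

-- A sum over all subsets whose summand vanishes off the subset X is the summand
-- at X, since every subset occurs exactly once.
∑-allSubsets-single : {v : ℕ} (X : Subset v) (f : Subset v → ℕ) → (∀ P → P ≢ X → f P ≡ 0) →
  ∑ (allSubsets v) f ≡ f X
∑-allSubsets-single {zero} [] f e = +-identityʳ _
∑-allSubsets-single {suc v} (outside ∷ X) f e = begin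
  ∑ (allSubsets (suc v)) f  ≡⟨ ∑-allSubsets-suc v f ⟩
  ∑ (allSubsets v) (f ∘ (outside ∷_)) + ∑ (allSubsets v) (f ∘ (inside ∷_))
    ≡⟨ cong₂ _+_ (∑-allSubsets-single X _ (λ P P≢X → e _ (P≢X ∘ ∷-injectiveʳ)))
                 (∑-zero (allSubsets v) _ (λ P → e _ (λ ()))) ⟩
  f (outside ∷ X) + 0       ≡⟨ +-identityʳ _ ⟩
  f (outside ∷ X)           ∎
∑-allSubsets-single {suc v} (inside ∷ X) f e = begin
  ∑ (allSubsets (suc v)) f  ≡⟨ ∑-allSubsets-suc v f ⟩
  ∑ (allSubsets v) (f ∘ (outside ∷_)) + ∑ (allSubsets v) (f ∘ (inside ∷_))
    ≡⟨ cong₂ _+_ (∑-zero (allSubsets v) _ (λ P → e _ (λ ())))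
                 (∑-allSubsets-single X _ (λ P P≢X → e _ (P≢X ∘ ∷-injectiveʳ))) ⟩
  f (inside ∷ X)            ∎

⟦∧⟧ : (a b : Bool) → ⟦ a ∧ b ⟧ ≡ ⟦ a ⟧ * ⟦ b ⟧
⟦∧⟧ true true = refl
⟦∧⟧ true false = refl
⟦∧⟧ false b = refl

⟦not⟧ : (b : Bool) → ⟦ not b ⟧ + ⟦ b ⟧ ≡ 1
⟦not⟧ true = refl
⟦not⟧ false = refl

⟦⟧≤1 : (b : Bool) → ⟦ b ⟧ ≤ 1
⟦⟧≤1 true = s≤s z≤n
⟦⟧≤1 false = z≤n

⟦⟧*⟦⟧≤1 : (a b : Bool) → ⟦ a ⟧ * ⟦ b ⟧ ≤ 1
⟦⟧*⟦⟧≤1 a b = subst (_≤ 1) (⟦∧⟧ a b) (⟦⟧≤1 (a ∧ b))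

⟦⟧*⟦⟧-pos : (a b : Bool) → 1 ≤ ⟦ a ⟧ * ⟦ b ⟧ → (a ≡ true) × (b ≡ true)
⟦⟧*⟦⟧-pos true true _ = refl , refl

⟦⟧*-cong : (b : Bool) {x y : ℕ} → (b ≡ true → x ≡ y) → ⟦ b ⟧ * x ≡ ⟦ b ⟧ * y
⟦⟧*-cong true h = cong (_+ 0) (h refl)
⟦⟧*-cong false h = refl

true≢false : true ≢ false
true≢false ()

≢true⇒≡false : {b : Bool} → b ≢ true → b ≡ false
≢true⇒≡false {true} ne = ⊥-elim (ne refl)
≢true⇒≡false {false} ne = refl

⌊⌋-sound : {A : Set} (d : Dec A) → ⌊ d ⌋ ≡ true → A
⌊⌋-sound (yes a) e = a

⌊⌋-complete : {A : Set} (d : Dec A) → A → ⌊ d ⌋ ≡ true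
⌊⌋-complete (yes a) _ = refl
⌊⌋-complete (no ¬a) a = ⊥-elim (¬a a)

⌊⌋-false : {A : Set} (d : Dec A) → ¬ A → ⌊ d ⌋ ≡ false
⌊⌋-false (yes a) ¬a = ⊥-elim (¬a a)
⌊⌋-false (no _) _ = refl

≡ᵇ-sound : (m n : ℕ) → (m ≡ᵇ n) ≡ true → m ≡ n
≡ᵇ-sound m n e = ≡ᵇ⇒≡ m n (subst True (sym e) tt)

⟦≡ᵇ⟧-refl : (m n : ℕ) → m ≡ n → ⟦ m ≡ᵇ n ⟧ ≡ 1
⟦≡ᵇ⟧-refl zero zero e = refl
⟦≡ᵇ⟧-refl (suc m) (suc n) e = ⟦≡ᵇ⟧-refl m n (suc-injective e)

<ᵇ-sound : (m n : ℕ) → (m <ᵇ n) ≡ true → m < n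
<ᵇ-sound m n e = <ᵇ⇒< m n (subst True (sym e) tt)

<ᵇ-complete : (m n : ℕ) → m < n → (m <ᵇ n) ≡ true
<ᵇ-complete m n lt with m <ᵇ n | <⇒<ᵇ {m} {n} lt
... | true | _ = refl

⟦<ᵇ⟧+⟦>ᵇ⟧ : (m n : ℕ) → m ≢ n → ⟦ m <ᵇ n ⟧ + ⟦ n <ᵇ m ⟧ ≡ 1
⟦<ᵇ⟧+⟦>ᵇ⟧ zero zero m≢n = ⊥-elim (m≢n refl)
⟦<ᵇ⟧+⟦>ᵇ⟧ zero (suc n) _ = refl
⟦<ᵇ⟧+⟦>ᵇ⟧ (suc m) zero _ = refl
⟦<ᵇ⟧+⟦>ᵇ⟧ (suc m) (suc n) m≢n = ⟦<ᵇ⟧+⟦>ᵇ⟧ m n (m≢n ∘ cong suc)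

∑-atMostOne : {n : ℕ} (f : Fin n → ℕ) → (∀ i → f i ≤ 1) → (∀ i j → 1 ≤ f i → 1 ≤ f j → i ≡ j) →
  ∑ (allFin n) f ≤ 1
∑-atMostOne {zero} f f≤1 uniq = z≤n
∑-atMostOne {suc n} f f≤1 uniq = subst (_≤ 1) (sym (∑-allFin-suc n f)) (byHead (f fzero) refl)
  where
  tailUniq : ∀ i j → 1 ≤ f (fsuc i) → 1 ≤ f (fsuc j) → i ≡ j
  tailUniq i j p q = FinP.suc-injective (uniq (fsuc i) (fsuc j) p q)
  tailZero : ∀ {m} → f fzero ≡ suc m → ∀ i → f (fsuc i) ≡ 0
  tailZero f0 i with f (fsuc i) in fi
  ... | zero = refl
  ... | suc _ with uniq fzero (fsuc i) (subst (1 ≤_) (sym f0) (s≤s z≤n)) (subst (1 ≤_) (sym fi) (s≤s z≤n))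
  ... | ()
  byHead : (m : ℕ) → f fzero ≡ m → f fzero + ∑ (allFin n) (f ∘ fsuc) ≤ 1
  byHead zero f0 rewrite f0 = ∑-atMostOne (f ∘ fsuc) (f≤1 ∘ fsuc) tailUniq
  byHead (suc m) f0 rewrite ∑-zero (allFin n) (f ∘ fsuc) (tailZero f0) | +-identityʳ (f fzero) = f≤1 fzero

any-allFin-suc : {n : ℕ} (g : Fin (suc n) → Bool) → any g (allFin (suc n)) ≡ g fzero ∨ any (g ∘ fsuc) (allFin n)
any-allFin-suc {n} g = begin
  any g (allFin (suc n))                     ≡⟨ cong (any g) (allFin-suc n) ⟩
  g fzero ∨ or (map g (map fsuc (allFin n)))  ≡⟨ cong (λ l → g fzero ∨ or l) (sym (ListP.map-∘ (allFin n))) ⟩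
  g fzero ∨ any (g ∘ fsuc) (allFin n)        ∎

any-intro : {n : ℕ} (g : Fin n → Bool) (i : Fin n) → g i ≡ true → any g (allFin n) ≡ true
any-intro {suc n} g fzero e rewrite any-allFin-suc g | e = refl
any-intro {suc n} g (fsuc i) e rewrite any-allFin-suc g | any-intro (g ∘ fsuc) i e = BoolP.∨-zeroʳ (g fzero)

any-elim : {n : ℕ} (g : Fin n → Bool) → any g (allFin n) ≡ true → Σ (Fin n) (λ i → g i ≡ true)
any-elim {suc n} g e rewrite any-allFin-suc g with g fzero in g0
... | true = fzero , g0
... | false with any-elim (g ∘ fsuc) e
... | i , gi = fsuc i , gi

⟦any⟧≡∑ : {n : ℕ} (g : Fin n → Bool) → (∀ i j → g i ≡ true → g j ≡ true → i ≡ j) →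
  ⟦ any g (allFin n) ⟧ ≡ ∑ (allFin n) (λ i → ⟦ g i ⟧)
⟦any⟧≡∑ {zero} g uniq = refl
⟦any⟧≡∑ {suc n} g uniq rewrite any-allFin-suc g | ∑-allFin-suc n (λ i → ⟦ g i ⟧) with g fzero in g0
... | true = sym (cong suc (∑-zero (allFin n) _ tailFalse))
  where
  tailFalse : ∀ i → ⟦ g (fsuc i) ⟧ ≡ 0
  tailFalse i with g (fsuc i) in gi
  ... | false = refl
  ... | true with uniq fzero (fsuc i) g0 gi
  ... | ()
... | false = ⟦any⟧≡∑ (g ∘ fsuc) (λ i j p q → FinP.suc-injective (uniq (fsuc i) (fsuc j) p q))

∣∷∣ : {n : ℕ} (b : Bool) (P : Subset n) → ∣ b ∷ P ∣ ≡ ⟦ b ⟧ + ∣ P ∣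
∣∷∣ true P = refl
∣∷∣ false P = refl

∣∣≡∑ : {n : ℕ} (P : Subset n) → ∣ P ∣ ≡ ∑ (allFin n) (λ i → ⟦ lookup P i ⟧)
∣∣≡∑ [] = refl
∣∣≡∑ {suc n} (x ∷ P) = begin
  ∣ x ∷ P ∣                                          ≡⟨ ∣∷∣ x P ⟩
  ⟦ x ⟧ + ∣ P ∣                                      ≡⟨ cong (⟦ x ⟧ +_) (∣∣≡∑ P) ⟩
  ⟦ x ⟧ + ∑ (allFin n) (λ i → ⟦ lookup P i ⟧)        ≡⟨ sym (∑-allFin-suc n (λ i → ⟦ lookup (x ∷ P) i ⟧)) ⟩
  ∑ (allFin (suc n)) (λ i → ⟦ lookup (x ∷ P) i ⟧)    ∎

∑-complement : {n k : ℕ} (P : Subset n) → ∣ P ∣ ≡ k → ∑ (allFin n) (λ i → ⟦ not (lookup P i) ⟧) ≡ n ∸ k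
∑-complement {n} {k} P ∣P∣≡k = begin
  ∑ (allFin n) (λ i → ⟦ not (lookup P i) ⟧)      ≡⟨ sym (m+n∸m≡n k _) ⟩
  k + ∑ (allFin n) (λ i → ⟦ not (lookup P i) ⟧) ∸ k
    ≡⟨ cong (λ m → m + ∑ (allFin n) (λ i → ⟦ not (lookup P i) ⟧) ∸ k) (trans (sym ∣P∣≡k) (∣∣≡∑ P)) ⟩
  ∑ (allFin n) (λ i → ⟦ lookup P i ⟧) + ∑ (allFin n) (λ i → ⟦ not (lookup P i) ⟧) ∸ k
    ≡⟨ cong (_∸ k) (sym (∑-+ (allFin n) _ _)) ⟩
  ∑ (allFin n) (λ i → ⟦ lookup P i ⟧ + ⟦ not (lookup P i) ⟧) ∸ k
    ≡⟨ cong (_∸ k) (∑-cong (allFin n) (λ i → trans (+-comm ⟦ lookup P i ⟧ _) (⟦not⟧ (lookup P i)))) ⟩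
  ∑ (allFin n) (λ _ → 1) ∸ k                   ≡⟨ cong (_∸ k) (∑-const n) ⟩
  n ∸ k                                         ∎
  where
  ∑-const : (n : ℕ) → ∑ (allFin n) (λ _ → 1) ≡ n
  ∑-const zero = refl
  ∑-const (suc n) = trans (∑-allFin-suc n (λ _ → 1)) (cong suc (∑-const n))

∣[]≔∣ : {n : ℕ} (P : Subset n) (i : Fin n) (b : Bool) → ∣ P [ i ]≔ b ∣ + ⟦ lookup P i ⟧ ≡ ∣ P ∣ + ⟦ b ⟧
∣[]≔∣ (x ∷ P) fzero b rewrite ∣∷∣ b P | ∣∷∣ x P = shuffle ⟦ x ⟧ ⟦ b ⟧ ∣ P ∣
  where
  shuffle : ∀ a b c → b + c + a ≡ a + c + b
  shuffle = solve-∀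
∣[]≔∣ (x ∷ P) (fsuc i) b rewrite ∣∷∣ x (P [ i ]≔ b) | ∣∷∣ x P =
  trans (+-assoc ⟦ x ⟧ _ _) (trans (cong (⟦ x ⟧ +_) (∣[]≔∣ P i b)) (sym (+-assoc ⟦ x ⟧ _ _)))

lookup-ext : {n : ℕ} (P Q : Subset n) → (∀ i → lookup P i ≡ lookup Q i) → P ≡ Q
lookup-ext P Q e = trans (sym (tabulate∘lookup P)) (trans (tabulate-cong e) (tabulate∘lookup Q))

_⊆ᵇ_ : {v : ℕ} → Subset v → Subset v → Bool
T ⊆ᵇ Q = ⌊ T ⊆? Q ⌋

⊆ᵇ-complete : {n : ℕ} (T Q : Subset n) → (∀ i → lookup T i ≡ true → lookup Q i ≡ true) → T ⊆ᵇ Q ≡ true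
⊆ᵇ-complete T Q h = ⌊⌋-complete (T ⊆? Q) (λ {i} i∈T → lookup⇒[]= i Q (h i ([]=⇒lookup i∈T)))

⊆ᵇ-∷ : {n : ℕ} (b c : Bool) (T Q : Subset n) → (b ∷ T) ⊆ᵇ (c ∷ Q) ≡ (not b ∨ c) ∧ T ⊆ᵇ Q
⊆ᵇ-∷ false c T Q with T ⊆? Q
... | yes _ = refl
... | no _ = refl
⊆ᵇ-∷ true true T Q with T ⊆? Q
... | yes _ = refl
... | no _ = refl
⊆ᵇ-∷ true false T Q = refl

⊆ᵇ⊤ : {v : ℕ} (T : Subset v) → T ⊆ᵇ ⊤ ≡ true
⊆ᵇ⊤ T = ⌊⌋-complete (T ⊆? ⊤) ⊆⊤

swap : {v : ℕ} → Subset v → Fin v → Fin v → Subset v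
swap P p q = (P [ p ]≔ outside) [ q ]≔ inside

_≡ˢ?_ : {v : ℕ} → Subset v → Subset v → Bool
Q ≡ˢ? X = ⌊ ≡-dec BoolP._≟_ Q X ⌋

move? : {v : ℕ} → Subset v → Subset v → Fin v → Fin v → Bool
move? P Q p q = (toℕ q <ᵇ toℕ p) ∧ lookup P p ∧ not (lookup P q) ∧ (Q ≡ˢ? swap P p q)

record Move {v : ℕ} (P Q : Subset v) (p q : Fin v) : Set where
  field
    q<p : toℕ q < toℕ p
    p∈P : lookup P p ≡ true
    q∉P : lookup P q ≡ false
    Q≡  : Q ≡ swap P p q

move?-sound : {v : ℕ} (P Q : Subset v) (p q : Fin v) → move? P Q p q ≡ true → Move P Q p q
move?-sound P Q p q e with toℕ q <ᵇ toℕ p in lt | lookup P p in pP | lookup P q in qP | Q ≡ˢ? swap P p q in eq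
move?-sound P Q p q refl | true | true | false | true = record
  { q<p = <ᵇ-sound _ _ lt ; p∈P = pP ; q∉P = qP ; Q≡ = ⌊⌋-sound (≡-dec BoolP._≟_ Q (swap P p q)) eq }

move?-complete : {v : ℕ} {P Q : Subset v} {p q : Fin v} → Move P Q p q → move? P Q p q ≡ true
move?-complete {P = P} {Q} {p} {q} m
  rewrite <ᵇ-complete (toℕ q) (toℕ p) (Move.q<p m) | Move.p∈P m | Move.q∉P m
  = ⌊⌋-complete (≡-dec BoolP._≟_ Q (swap P p q)) (Move.Q≡ m)

<⇒≢ᶠ : {v : ℕ} {p q : Fin v} → toℕ q < toℕ p → q ≢ p
<⇒≢ᶠ lt refl = <-irrefl refl lt

swap-q : {v : ℕ} (P : Subset v) (p q : Fin v) → lookup (swap P p q) q ≡ true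
swap-q P p q = lookup∘update q (P [ p ]≔ outside) inside

swap-p : {v : ℕ} (P : Subset v) (p q : Fin v) → q ≢ p → lookup (swap P p q) p ≡ false
swap-p P p q q≢p = trans (lookup∘update′ (q≢p ∘ sym) (P [ p ]≔ outside) inside) (lookup∘update p P outside)

swap-other : {v : ℕ} (P : Subset v) (p q j : Fin v) → q ≢ j → p ≢ j → lookup (swap P p q) j ≡ lookup P j
swap-other P p q j q≢j p≢j =
  trans (lookup∘update′ (q≢j ∘ sym) (P [ p ]≔ outside) inside) (lookup∘update′ (p≢j ∘ sym) P outside)

∣swap∣ : {v : ℕ} (P : Subset v) (p q : Fin v) → q ≢ p → lookup P p ≡ true → lookup P q ≡ false →
  ∣ swap P p q ∣ ≡ ∣ P ∣
∣swap∣ P p q q≢p p∈P q∉P = +-cancelʳ-≡ 0 _ _ (begin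
  ∣ swap P p q ∣ + 0                ≡⟨ cong (λ b → ∣ swap P p q ∣ + ⟦ b ⟧) (sym q∉P-p) ⟩
  ∣ swap P p q ∣ + ⟦ lookup (P [ p ]≔ outside) q ⟧  ≡⟨ ∣[]≔∣ (P [ p ]≔ outside) q inside ⟩
  ∣ P [ p ]≔ outside ∣ + 1         ≡⟨ cong (λ b → ∣ P [ p ]≔ outside ∣ + ⟦ b ⟧) (sym p∈P) ⟩
  ∣ P [ p ]≔ outside ∣ + ⟦ lookup P p ⟧  ≡⟨ ∣[]≔∣ P p outside ⟩
  ∣ P ∣ + 0                        ∎)
  where
  q∉P-p : lookup (P [ p ]≔ outside) q ≡ false
  q∉P-p = trans (lookup∘update′ q≢p P outside) q∉P

swap-swap : {v : ℕ} (P : Subset v) (p q : Fin v) → q ≢ p → lookup P p ≡ true → lookup P q ≡ false →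
  swap (swap P p q) q p ≡ P
swap-swap P p q q≢p p∈P q∉P = lookup-ext _ _ coordinate
  where
  coordinate : ∀ j → lookup (swap (swap P p q) q p) j ≡ lookup P j
  coordinate j with p FinP.≟ j | q FinP.≟ j
  ... | yes refl | _ = trans (swap-q (swap P p q) q j) (sym p∈P)
  ... | no p≢j | yes refl = trans (swap-p (swap P p q) q p p≢j) (sym q∉P)
  ... | no p≢j | no q≢j = trans (swap-other (swap P p q) q p j p≢j q≢j) (swap-other P p q j q≢j p≢j)

move-unique-p : {v : ℕ} {P Q : Subset v} {p q p' q' : Fin v} → Move P Q p q → Move P Q p' q' → p ≡ p'
move-unique-p {P = P} {Q} {p} {q} {p'} {q'} m m' with p FinP.≟ p'
... | yes p≡p' = p≡p'
... | no p≢p' = ⊥-elim (true≢false (begin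
  true                      ≡⟨ sym p'∈swap ⟩
  lookup (swap P p q) p'    ≡⟨ cong (λ R → lookup R p') (sym (Move.Q≡ m)) ⟩
  lookup Q p'               ≡⟨ cong (λ R → lookup R p') (Move.Q≡ m') ⟩
  lookup (swap P p' q') p'  ≡⟨ swap-p P p' q' (<⇒≢ᶠ (Move.q<p m')) ⟩
  false                     ∎))
  where
  p'∈swap : lookup (swap P p q) p' ≡ true
  p'∈swap with q FinP.≟ p'
  ... | yes refl = ⊥-elim (true≢false (trans (sym (Move.p∈P m')) (Move.q∉P m)))
  ... | no q≢p' = trans (swap-other P p q p' q≢p' p≢p') (Move.p∈P m')

move-unique-q : {v : ℕ} {P Q : Subset v} {p q q' : Fin v} → Move P Q p q → Move P Q p q' → q ≡ q'
move-unique-q {P = P} {Q} {p} {q} {q'} m m' with q FinP.≟ q'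
... | yes q≡q' = q≡q'
... | no q≢q' = ⊥-elim (true≢false (begin
  true                     ≡⟨ sym (swap-q P p q') ⟩
  lookup (swap P p q') q'  ≡⟨ cong (λ R → lookup R q') (trans (sym (Move.Q≡ m')) (Move.Q≡ m)) ⟩
  lookup (swap P p q) q'   ≡⟨ q'∉swap ⟩
  false                    ∎))
  where
  q'∉swap : lookup (swap P p q) q' ≡ false
  q'∉swap with p FinP.≟ q'
  ... | yes refl = ⊥-elim (true≢false (trans (sym (Move.p∈P m)) (Move.q∉P m')))
  ... | no p≢q' = trans (swap-other P p q q' q≢q' p≢q') (Move.q∉P m')

∑² : {v : ℕ} → (Fin v → Fin v → ℕ) → ℕ
∑² {v} f = ∑ (allFin v) (λ p → ∑ (allFin v) (f p))

∑²-cong : {v : ℕ} {f g : Fin v → Fin v → ℕ} → (∀ p q → f p q ≡ g p q) → ∑² f ≡ ∑² g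
∑²-cong {v} e = ∑-cong (allFin v) (λ p → ∑-cong (allFin v) (e p))

-- Since moves are unique, the edge indicator is the number of moves from P to Q.
⟦edge⟧≡∑² : {v : ℕ} (P Q : Subset v) → ⟦ edge P Q ⟧ ≡ ∑² (λ p q → ⟦ move? P Q p q ⟧)
⟦edge⟧≡∑² {v} P Q =
  trans (⟦any⟧≡∑ (λ p → any (move? P Q p) (allFin v)) unique-p)
        (∑-cong (allFin v) (λ p → ⟦any⟧≡∑ (move? P Q p) (unique-q p)))
  where
  unique-q : ∀ p i j → move? P Q p i ≡ true → move? P Q p j ≡ true → i ≡ j
  unique-q p i j mi mj = move-unique-q (move?-sound P Q p i mi) (move?-sound P Q p j mj)
  unique-p : ∀ i j → any (move? P Q i) (allFin v) ≡ true → any (move? P Q j) (allFin v) ≡ true → i ≡ j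
  unique-p i j mi mj with any-elim (move? P Q i) mi | any-elim (move? P Q j) mj
  ... | q , e | q' , e' = move-unique-p (move?-sound P Q i q e) (move?-sound P Q j q' e')

edge-intro : {v : ℕ} {P Q : Subset v} {p q : Fin v} → Move P Q p q → edge P Q ≡ true
edge-intro {v} {P} {Q} {p} {q} m =
  any-intro (λ p → any (move? P Q p) (allFin v)) p (any-intro (move? P Q p) q (move?-complete m))

edge-elim : {v : ℕ} {P Q : Subset v} → edge P Q ≡ true → Σ (Fin v) λ p → Σ (Fin v) λ q → Move P Q p q
edge-elim {v} {P} {Q} e with any-elim (λ p → any (move? P Q p) (allFin v)) e
... | p , e' with any-elim (move? P Q p) e'
... | q , e'' = p , q , move?-sound P Q p q e''

∧∧not-sound : {x y z : Bool} → x ∧ y ∧ not z ≡ true → (x ≡ true) × (y ≡ true) × (z ≡ false)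
∧∧not-sound {true} {true} {false} _ = refl , refl , refl

∧∧not-complete : {x y z : Bool} → x ≡ true → y ≡ true → z ≡ false → x ∧ y ∧ not z ≡ true
∧∧not-complete refl refl refl = refl

leaving? : {v : ℕ} → Subset v → Fin v → Fin v → Bool
leaving? P p q = (toℕ q <ᵇ toℕ p) ∧ lookup P p ∧ not (lookup P q)

entering? : {v : ℕ} → Subset v → Fin v → Fin v → Bool
entering? Q p q = (toℕ q <ᵇ toℕ p) ∧ lookup Q q ∧ not (lookup Q p)

move⇒entering : {v : ℕ} (P Q : Subset v) (p q : Fin v) → move? P Q p q ≡ true →
  (P ≡ swap Q q p) × (entering? Q p q ≡ true) × (∣ P ∣ ≡ ∣ Q ∣)
move⇒entering P Q p q e = P≡ , ∧∧not-complete (<ᵇ-complete _ _ (Move.q<p m)) q∈Q p∉Q , sym ∣Q∣≡∣P∣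
  where
  m = move?-sound P Q p q e
  q≢p = <⇒≢ᶠ (Move.q<p m)
  P≡ : P ≡ swap Q q p
  P≡ = trans (sym (swap-swap P p q q≢p (Move.p∈P m) (Move.q∉P m))) (cong (λ R → swap R q p) (sym (Move.Q≡ m)))
  q∈Q : lookup Q q ≡ true
  q∈Q = trans (cong (λ R → lookup R q) (Move.Q≡ m)) (swap-q P p q)
  p∉Q : lookup Q p ≡ false
  p∉Q = trans (cong (λ R → lookup R p) (Move.Q≡ m)) (swap-p P p q q≢p)
  ∣Q∣≡∣P∣ : ∣ Q ∣ ≡ ∣ P ∣
  ∣Q∣≡∣P∣ = trans (cong ∣_∣ (Move.Q≡ m)) (∣swap∣ P p q q≢p (Move.p∈P m) (Move.q∉P m))

entering⇒move : {v : ℕ} (Q : Subset v) (p q : Fin v) → entering? Q p q ≡ true →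
  (move? (swap Q q p) Q p q ≡ true) × (∣ swap Q q p ∣ ≡ ∣ Q ∣)
entering⇒move Q p q e with ∧∧not-sound {toℕ q <ᵇ toℕ p} e
... | lt , q∈Q , p∉Q = move?-complete m , ∣swap∣ Q q p p≢q q∈Q p∉Q
  where
  p≢q : p ≢ q
  p≢q = <⇒≢ᶠ (<ᵇ-sound _ _ lt) ∘ sym
  m : Move (swap Q q p) Q p q
  m = record { q<p = <ᵇ-sound _ _ lt ; p∈P = swap-q Q q p ; q∉P = swap-p Q q p p≢q
             ; Q≡ = sym (swap-swap Q q p p≢q q∈Q p∉Q) }

∑-∑²-swap : {A : Set} {v : ℕ} (L : List A) (c : A → ℕ) (g : A → Fin v → Fin v → ℕ) →
  ∑ L (λ P → c P * ∑² (g P)) ≡ ∑² (λ p q → ∑ L (λ P → c P * g P p q))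
∑-∑²-swap {v = v} L c g =
  trans (∑-cong L (λ P → trans (sym (∑-*ˡ (allFin v) (c P) _)) (∑-cong (allFin v) (λ p → sym (∑-*ˡ (allFin v) (c P) (g P p))))))
  (trans (∑-swap L (allFin v) _) (∑-cong (allFin v) (λ p → ∑-swap L (allFin v) _)))

in-degree : {v : ℕ} (k : ℕ) (Q : Subset v) → ∣ Q ∣ ≡ k →
  ∑ (allSubsets v) (λ P → ⟦ ∣ P ∣ ≡ᵇ k ⟧ * ⟦ edge P Q ⟧) ≡ ∑² (λ p q → ⟦ entering? Q p q ⟧)
in-degree {v} k Q ∣Q∣≡k = begin
  ∑ (allSubsets v) (λ P → ⟦ ∣ P ∣ ≡ᵇ k ⟧ * ⟦ edge P Q ⟧)
    ≡⟨ ∑-cong (allSubsets v) (λ P → cong (⟦ ∣ P ∣ ≡ᵇ k ⟧ *_) (⟦edge⟧≡∑² P Q)) ⟩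
  ∑ (allSubsets v) (λ P → ⟦ ∣ P ∣ ≡ᵇ k ⟧ * ∑² (λ p q → ⟦ move? P Q p q ⟧))
    ≡⟨ ∑-∑²-swap (allSubsets v) (λ P → ⟦ ∣ P ∣ ≡ᵇ k ⟧) (λ P p q → ⟦ move? P Q p q ⟧) ⟩
  ∑² (λ p q → ∑ (allSubsets v) (λ P → ⟦ ∣ P ∣ ≡ᵇ k ⟧ * ⟦ move? P Q p q ⟧))
    ≡⟨ ∑²-cong (λ p q → trans (∑-allSubsets-single (swap Q q p) _ (offSource p q)) (atSource p q)) ⟩
  ∑² (λ p q → ⟦ entering? Q p q ⟧) ∎
  where
  offSource : ∀ p q P → P ≢ swap Q q p → ⟦ ∣ P ∣ ≡ᵇ k ⟧ * ⟦ move? P Q p q ⟧ ≡ 0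
  offSource p q P P≢ with move? P Q p q in e
  ... | false = *-zeroʳ ⟦ ∣ P ∣ ≡ᵇ k ⟧
  ... | true = ⊥-elim (P≢ (proj₁ (move⇒entering P Q p q e)))
  atSource : ∀ p q → ⟦ ∣ swap Q q p ∣ ≡ᵇ k ⟧ * ⟦ move? (swap Q q p) Q p q ⟧ ≡ ⟦ entering? Q p q ⟧
  atSource p q with entering? Q p q in e
  ... | true with entering⇒move Q p q e
  ... | isMove , ∣P∣≡∣Q∣ rewrite isMove | ⟦≡ᵇ⟧-refl _ _ (trans ∣P∣≡∣Q∣ ∣Q∣≡k) = refl
  atSource p q | false with move? (swap Q q p) Q p q in e'
  ... | false = *-zeroʳ ⟦ ∣ swap Q q p ∣ ≡ᵇ k ⟧
  ... | true = ⊥-elim (true≢false (trans (sym (proj₁ (proj₂ (move⇒entering (swap Q q p) Q p q e')))) e))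

blocks-reached : {v : ℕ} (B : BlockSet v) (P : Subset v) →
  ∑ (allSubsets v) (λ Q → ⟦ B Q ⟧ * ⟦ edge P Q ⟧) ≡ ∑² (λ p q → ⟦ leaving? P p q ⟧ * ⟦ B (swap P p q) ⟧)
blocks-reached {v} B P = begin
  ∑ (allSubsets v) (λ Q → ⟦ B Q ⟧ * ⟦ edge P Q ⟧)
    ≡⟨ ∑-cong (allSubsets v) (λ Q → cong (⟦ B Q ⟧ *_) (⟦edge⟧≡∑² P Q)) ⟩
  ∑ (allSubsets v) (λ Q → ⟦ B Q ⟧ * ∑² (λ p q → ⟦ move? P Q p q ⟧))
    ≡⟨ ∑-∑²-swap (allSubsets v) (λ Q → ⟦ B Q ⟧) (λ Q p q → ⟦ move? P Q p q ⟧) ⟩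
  ∑² (λ p q → ∑ (allSubsets v) (λ Q → ⟦ B Q ⟧ * ⟦ move? P Q p q ⟧))
    ≡⟨ ∑²-cong (λ p q → trans (∑-allSubsets-single (swap P p q) _ (offTarget p q)) (atTarget p q)) ⟩
  ∑² (λ p q → ⟦ leaving? P p q ⟧ * ⟦ B (swap P p q) ⟧) ∎
  where
  offTarget : ∀ p q Q → Q ≢ swap P p q → ⟦ B Q ⟧ * ⟦ move? P Q p q ⟧ ≡ 0
  offTarget p q Q Q≢ with move? P Q p q in e
  ... | false = *-zeroʳ ⟦ B Q ⟧
  ... | true = ⊥-elim (Q≢ (Move.Q≡ (move?-sound P Q p q e)))
  atTarget : ∀ p q → ⟦ B (swap P p q) ⟧ * ⟦ move? P (swap P p q) p q ⟧ ≡ ⟦ leaving? P p q ⟧ * ⟦ B (swap P p q) ⟧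
  atTarget p q rewrite ⌊⌋-complete (≡-dec BoolP._≟_ (swap P p q) (swap P p q)) refl
                     | BoolP.∧-identityʳ (not (lookup P q)) = *-comm ⟦ B (swap P p q) ⟧ ⟦ leaving? P p q ⟧

-- Two moves (p , q) and (p , q') out of P with q < q' lead to adjacent sets:
-- P - p + q' → P - p + q by the move (q' , q).
swap-adjacent : {v : ℕ} (P : Subset v) (p q q' : Fin v) → leaving? P p q ≡ true → leaving? P p q' ≡ true →
  toℕ q < toℕ q' → Move (swap P p q') (swap P p q) q' q
swap-adjacent P p q q' l l' q<q' with ∧∧not-sound {toℕ q <ᵇ toℕ p} l | ∧∧not-sound {toℕ q' <ᵇ toℕ p} l'
... | q<p , p∈P , q∉P | q'<p , _ , q'∉P = record
  { q<p = q<q' ; p∈P = swap-q P p q' ; q∉P = trans (swap-other P p q' q (q≢q' ∘ sym) (p≢ q<p)) q∉P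
  ; Q≡ = lookup-ext _ _ coordinate }
  where
  q≢q' : q ≢ q'
  q≢q' = <⇒≢ᶠ q<q'
  p≢ : ∀ {r} → (toℕ r <ᵇ toℕ p) ≡ true → p ≢ r
  p≢ r<p = <⇒≢ᶠ (<ᵇ-sound _ _ r<p) ∘ sym
  coordinate : ∀ j → lookup (swap P p q) j ≡ lookup (swap (swap P p q') q' q) j
  coordinate j with q FinP.≟ j | q' FinP.≟ j | p FinP.≟ j
  ... | yes refl | _ | _ = trans (swap-q P p q) (sym (swap-q (swap P p q') q' q))
  ... | no q≢j | yes refl | _ = trans (swap-other P p q q' q≢j (p≢ q'<p)) (trans q'∉P (sym (swap-p (swap P p q') q' q q≢j)))
  ... | no q≢j | no q'≢j | yes refl =
    trans (swap-p P p q q≢j) (sym (trans (swap-other (swap P p q') q' q p q≢j q'≢j) (swap-p P p q' q'≢j)))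
  ... | no q≢j | no q'≢j | no p≢j =
    trans (swap-other P p q j q≢j p≢j) (sym (trans (swap-other (swap P p q') q' q j q≢j q'≢j) (swap-other P p q' j q'≢j p≢j)))

blocks-reached-via : {v : ℕ} (k : ℕ) (B : BlockSet v) → Independent v k B → (P : Subset v) → ∣ P ∣ ≡ k →
  (p : Fin v) → ∑ (allFin v) (λ q → ⟦ leaving? P p q ⟧ * ⟦ B (swap P p q) ⟧) ≤ ⟦ lookup P p ⟧
blocks-reached-via {v} k B indep P ∣P∣≡k p = byMembership (lookup P p) refl
  where
  reach : Fin v → ℕ
  reach q = ⟦ leaving? P p q ⟧ * ⟦ B (swap P p q) ⟧
  ∣target∣ : ∀ q → leaving? P p q ≡ true → ∣ swap P p q ∣ ≡ k
  ∣target∣ q l with ∧∧not-sound {toℕ q <ᵇ toℕ p} l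
  ... | q<p , p∈P , q∉P = trans (∣swap∣ P p q (<⇒≢ᶠ (<ᵇ-sound _ _ q<p)) p∈P q∉P) ∣P∣≡k
  unique : ∀ i j → 1 ≤ reach i → 1 ≤ reach j → i ≡ j
  unique i j ri rj with ⟦⟧*⟦⟧-pos (leaving? P p i) _ ri | ⟦⟧*⟦⟧-pos (leaving? P p j) _ rj | <-cmp (toℕ i) (toℕ j)
  ... | li , bi | lj , bj | tri< i<j _ _ = ⊥-elim (true≢false (trans (sym (edge-intro (swap-adjacent P p i j li lj i<j)))
                                             (indep _ _ (∣target∣ j lj) (∣target∣ i li) bj bi)))
  ... | _ | _ | tri≈ _ i≡j _ = FinP.toℕ-injective i≡j
  ... | li , bi | lj , bj | tri> _ _ j<i = ⊥-elim (true≢false (trans (sym (edge-intro (swap-adjacent P p j i lj li j<i)))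
                                             (indep _ _ (∣target∣ i li) (∣target∣ j lj) bi bj)))
  noMove : lookup P p ≡ false → ∀ q → reach q ≡ 0
  noMove p∉P q with leaving? P p q in l
  ... | false = refl
  ... | true = ⊥-elim (true≢false (trans (sym (proj₁ (proj₂ (∧∧not-sound {toℕ q <ᵇ toℕ p} l)))) p∉P))
  byMembership : (b : Bool) → lookup P p ≡ b → ∑ (allFin v) reach ≤ ⟦ b ⟧
  byMembership false p∉P = ≤-reflexive (∑-zero (allFin v) _ (noMove p∉P))
  byMembership true _ = ∑-atMostOne reach (λ q → ⟦⟧*⟦⟧≤1 (leaving? P p q) (B (swap P p q))) unique

blocks-reached≤k : {v : ℕ} (k : ℕ) (B : BlockSet v) → Independent v k B → (P : Subset v) → ∣ P ∣ ≡ k →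
  ∑ (allSubsets v) (λ Q → ⟦ B Q ⟧ * ⟦ edge P Q ⟧) ≤ k
blocks-reached≤k {v} k B indep P ∣P∣≡k =
  ≤-trans (≤-reflexive (blocks-reached B P))
  (≤-trans (∑-mono (allFin v) (blocks-reached-via k B indep P ∣P∣≡k))
           (≤-reflexive (trans (sym (∣∣≡∑ P)) ∣P∣≡k)))

subsets : {v : ℕ} → Subset v → ℕ → ℕ
subsets {v} Q t = ∑ (allSubsets v) (λ T → ⟦ ∣ T ∣ ≡ᵇ t ⟧ * ⟦ T ⊆ᵇ Q ⟧)

subsetsThrough : {v : ℕ} → Subset v → Fin v → ℕ → ℕ
subsetsThrough {v} Q x t = ∑ (allSubsets v) (λ T → ⟦ ∣ T ∣ ≡ᵇ t ⟧ * (⟦ lookup T x ⟧ * ⟦ T ⊆ᵇ Q ⟧))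

-- Q has ∣ Q ∣ C t subsets of size t (Pascal's rule, splitting on the first point).
subsets≡C : {v : ℕ} (Q : Subset v) (t : ℕ) → subsets Q t ≡ ∣ Q ∣ C t
subsets≡C {zero} [] zero = refl
subsets≡C {zero} [] (suc t) = refl
subsets≡C {suc v} (c ∷ Q) t = trans (∑-allSubsets-suc v _) (byFirstPoint c t)
  where
  withoutFirst : ∀ c t → ∑ (allSubsets v) (λ T → ⟦ ∣ outside ∷ T ∣ ≡ᵇ t ⟧ * ⟦ (outside ∷ T) ⊆ᵇ (c ∷ Q) ⟧) ≡ ∣ Q ∣ C t
  withoutFirst c t = trans (∑-cong (allSubsets v) (λ T → cong (λ b → ⟦ ∣ T ∣ ≡ᵇ t ⟧ * ⟦ b ⟧) (⊆ᵇ-∷ false c T Q))) (subsets≡C Q t)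
  withFirst₀ : ∀ c → ∑ (allSubsets v) (λ T → ⟦ ∣ inside ∷ T ∣ ≡ᵇ 0 ⟧ * ⟦ (inside ∷ T) ⊆ᵇ (c ∷ Q) ⟧) ≡ 0
  withFirst₀ c = ∑-zero (allSubsets v) _ (λ T → refl)
  byFirstPoint : ∀ c t → ∑ (allSubsets v) (λ T → ⟦ ∣ outside ∷ T ∣ ≡ᵇ t ⟧ * ⟦ (outside ∷ T) ⊆ᵇ (c ∷ Q) ⟧)
                       + ∑ (allSubsets v) (λ T → ⟦ ∣ inside ∷ T ∣ ≡ᵇ t ⟧ * ⟦ (inside ∷ T) ⊆ᵇ (c ∷ Q) ⟧) ≡ ∣ c ∷ Q ∣ C t
  byFirstPoint c zero = trans (cong₂ _+_ (withoutFirst c zero) (withFirst₀ c)) (+-identityʳ _)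
  byFirstPoint false (suc t) = trans (cong₂ _+_ (withoutFirst false (suc t))
    (∑-zero (allSubsets v) _ (λ T → trans (cong (λ b → ⟦ ∣ T ∣ ≡ᵇ t ⟧ * ⟦ b ⟧) (⊆ᵇ-∷ true false T Q)) (*-zeroʳ ⟦ ∣ T ∣ ≡ᵇ t ⟧))))
    (+-identityʳ _)
  byFirstPoint true (suc t) = begin
    ∑ (allSubsets v) (λ T → ⟦ ∣ outside ∷ T ∣ ≡ᵇ suc t ⟧ * ⟦ (outside ∷ T) ⊆ᵇ (true ∷ Q) ⟧)
      + ∑ (allSubsets v) (λ T → ⟦ ∣ inside ∷ T ∣ ≡ᵇ suc t ⟧ * ⟦ (inside ∷ T) ⊆ᵇ (true ∷ Q) ⟧)
                               ≡⟨ cong₂ _+_ (withoutFirst true (suc t)) (∑-cong (allSubsets v) (λ T → cong (λ b → ⟦ ∣ T ∣ ≡ᵇ t ⟧ * ⟦ b ⟧) (⊆ᵇ-∷ true true T Q))) ⟩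
    ∣ Q ∣ C suc t + subsets Q t ≡⟨ cong (∣ Q ∣ C suc t +_) (subsets≡C Q t) ⟩
    ∣ Q ∣ C suc t + ∣ Q ∣ C t   ≡⟨ +-comm (∣ Q ∣ C suc t) _ ⟩
    ∣ Q ∣ C t + ∣ Q ∣ C suc t   ≡⟨ nCk+nC[k+1]≡[n+1]C[k+1] ∣ Q ∣ t ⟩
    suc ∣ Q ∣ C suc t           ∎

∈⇒∣∣≢0 : {v : ℕ} (T : Subset v) (x : Fin v) → lookup T x ≡ true → ∣ T ∣ ≢ 0
∈⇒∣∣≢0 (true ∷ T) fzero x∈T ()
∈⇒∣∣≢0 (b ∷ T) (fsuc x) x∈T ∣T∣≡0 = ∈⇒∣∣≢0 T x x∈T (m+n≡0⇒n≡0 ⟦ b ⟧ (trans (sym (∣∷∣ b T)) ∣T∣≡0))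

subsetsThrough-0 : {v : ℕ} (Q : Subset v) (x : Fin v) → subsetsThrough Q x 0 ≡ 0
subsetsThrough-0 {v} Q x = ∑-zero (allSubsets v) _ term
  where
  term : ∀ T → ⟦ ∣ T ∣ ≡ᵇ 0 ⟧ * (⟦ lookup T x ⟧ * ⟦ T ⊆ᵇ Q ⟧) ≡ 0
  term T with ∣ T ∣ in e | lookup T x in x∈T
  ... | suc _ | _ = refl
  ... | zero | false = refl
  ... | zero | true = ⊥-elim (∈⇒∣∣≢0 T x x∈T e)

pascal-through : (b : Bool) (n s : ℕ) → (b ≡ true → n ≢ 0) →
  ⟦ b ⟧ * ((n ∸ 1) C suc s) + ⟦ b ⟧ * ((n ∸ 1) C s) ≡ ⟦ b ⟧ * (n C suc s)
pascal-through false n s _ = refl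
pascal-through true zero s n≢0 = ⊥-elim (n≢0 refl refl)
pascal-through true (suc m) s _ = begin
  1 * (m C suc s) + 1 * (m C s)  ≡⟨ cong₂ _+_ (*-identityˡ (m C suc s)) (*-identityˡ (m C s)) ⟩
  m C suc s + m C s              ≡⟨ +-comm (m C suc s) (m C s) ⟩
  m C s + m C suc s              ≡⟨ nCk+nC[k+1]≡[n+1]C[k+1] m s ⟩
  suc m C suc s                  ≡⟨ sym (*-identityˡ _) ⟩
  1 * (suc m C suc s)            ∎

-- The (s+1)-subsets of Q through x correspond to the s-subsets of Q - x.
subsetsThrough≡C : {v : ℕ} (Q : Subset v) (x : Fin v) (s : ℕ) →
  subsetsThrough Q x (suc s) ≡ ⟦ lookup Q x ⟧ * ((∣ Q ∣ ∸ 1) C s)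
subsetsThrough≡C {suc v} (c ∷ Q) fzero s = trans (∑-allSubsets-suc v _) (cong₂ _+_ withoutFirst (withFirst c))
  where
  withoutFirst : ∑ (allSubsets v) (λ T → ⟦ ∣ outside ∷ T ∣ ≡ᵇ suc s ⟧ * (0 * ⟦ (outside ∷ T) ⊆ᵇ (c ∷ Q) ⟧)) ≡ 0
  withoutFirst = ∑-zero (allSubsets v) _ (λ T → *-zeroʳ ⟦ ∣ T ∣ ≡ᵇ suc s ⟧)
  withFirst : ∀ c → ∑ (allSubsets v) (λ T → ⟦ ∣ inside ∷ T ∣ ≡ᵇ suc s ⟧ * (1 * ⟦ (inside ∷ T) ⊆ᵇ (c ∷ Q) ⟧))
               ≡ ⟦ c ⟧ * ((∣ c ∷ Q ∣ ∸ 1) C s)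
  withFirst false = ∑-zero (allSubsets v) _
    (λ T → trans (cong (λ b → ⟦ ∣ T ∣ ≡ᵇ s ⟧ * (1 * ⟦ b ⟧)) (⊆ᵇ-∷ true false T Q)) (*-zeroʳ ⟦ ∣ T ∣ ≡ᵇ s ⟧))
  withFirst true = begin
    ∑ (allSubsets v) (λ T → ⟦ ∣ T ∣ ≡ᵇ s ⟧ * (1 * ⟦ (inside ∷ T) ⊆ᵇ (true ∷ Q) ⟧))
      ≡⟨ ∑-cong (allSubsets v) (λ T → cong (⟦ ∣ T ∣ ≡ᵇ s ⟧ *_) (trans (*-identityˡ _) (cong ⟦_⟧ (⊆ᵇ-∷ true true T Q)))) ⟩
    subsets Q s         ≡⟨ subsets≡C Q s ⟩
    ∣ Q ∣ C s           ≡⟨ sym (*-identityˡ _) ⟩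
    1 * (∣ Q ∣ C s)     ∎
subsetsThrough≡C {suc v} (c ∷ Q) (fsuc x) s = begin
  subsetsThrough (c ∷ Q) (fsuc x) (suc s)
    ≡⟨ ∑-allSubsets-suc v _ ⟩
  ∑ (allSubsets v) (λ T → ⟦ ∣ T ∣ ≡ᵇ suc s ⟧ * (⟦ lookup T x ⟧ * ⟦ (outside ∷ T) ⊆ᵇ (c ∷ Q) ⟧))
    + ∑ (allSubsets v) (λ T → ⟦ ∣ inside ∷ T ∣ ≡ᵇ suc s ⟧ * (⟦ lookup T x ⟧ * ⟦ (inside ∷ T) ⊆ᵇ (c ∷ Q) ⟧))
    ≡⟨ cong₂ _+_ (trans (∑-cong (allSubsets v) (λ T → cong (λ b → ⟦ ∣ T ∣ ≡ᵇ suc s ⟧ * (⟦ lookup T x ⟧ * ⟦ b ⟧)) (⊆ᵇ-∷ false c T Q)))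
                        (subsetsThrough≡C Q x s))
                 (withFirst c) ⟩
  ⟦ lookup Q x ⟧ * ((∣ Q ∣ ∸ 1) C s) + ⟦ c ⟧ * subsetsThrough Q x s
    ≡⟨ combine c s ⟩
  ⟦ lookup Q x ⟧ * ((∣ c ∷ Q ∣ ∸ 1) C s) ∎
  where
  withFirst : ∀ c → ∑ (allSubsets v) (λ T → ⟦ ∣ T ∣ ≡ᵇ s ⟧ * (⟦ lookup T x ⟧ * ⟦ (inside ∷ T) ⊆ᵇ (c ∷ Q) ⟧))
               ≡ ⟦ c ⟧ * subsetsThrough Q x s
  withFirst false = ∑-zero (allSubsets v) _ (λ T → begin
    ⟦ ∣ T ∣ ≡ᵇ s ⟧ * (⟦ lookup T x ⟧ * ⟦ (inside ∷ T) ⊆ᵇ (false ∷ Q) ⟧)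
      ≡⟨ cong (λ b → ⟦ ∣ T ∣ ≡ᵇ s ⟧ * (⟦ lookup T x ⟧ * ⟦ b ⟧)) (⊆ᵇ-∷ true false T Q) ⟩
    ⟦ ∣ T ∣ ≡ᵇ s ⟧ * (⟦ lookup T x ⟧ * 0)
      ≡⟨ cong (⟦ ∣ T ∣ ≡ᵇ s ⟧ *_) (*-zeroʳ ⟦ lookup T x ⟧) ⟩
    ⟦ ∣ T ∣ ≡ᵇ s ⟧ * 0 ≡⟨ *-zeroʳ ⟦ ∣ T ∣ ≡ᵇ s ⟧ ⟩
    0 ∎)
  withFirst true = trans (∑-cong (allSubsets v) (λ T → cong (λ b → ⟦ ∣ T ∣ ≡ᵇ s ⟧ * (⟦ lookup T x ⟧ * ⟦ b ⟧)) (⊆ᵇ-∷ true true T Q)))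
                     (sym (+-identityʳ _))
  combine : ∀ c s → ⟦ lookup Q x ⟧ * ((∣ Q ∣ ∸ 1) C s) + ⟦ c ⟧ * subsetsThrough Q x s ≡ ⟦ lookup Q x ⟧ * ((∣ c ∷ Q ∣ ∸ 1) C s)
  combine false s = +-identityʳ _
  combine true zero rewrite subsetsThrough-0 Q x = +-identityʳ _
  combine true (suc s) rewrite +-identityʳ (subsetsThrough Q x (suc s)) | subsetsThrough≡C Q x s =
    pascal-through (lookup Q x) ∣ Q ∣ s (∈⇒∣∣≢0 Q x)

C-pos : (n s : ℕ) → s ≤ n → 1 ≤ n C s
C-pos n zero _ = s≤s z≤n
C-pos (suc n) (suc s) (s≤s s≤n) =
  ≤-trans (C-pos n s s≤n) (≤-trans (m≤m+n (n C s) (n C suc s)) (≤-reflexive (nCk+nC[k+1]≡[n+1]C[k+1] n s)))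

flags : {v : ℕ} (B : BlockSet v) (w : Subset v → ℕ) →
  ∑ (allSubsets v) (λ T → w T * count (λ Q → B Q ∧ T ⊆ᵇ Q) (allSubsets v))
  ≡ ∑ (allSubsets v) (λ Q → ⟦ B Q ⟧ * ∑ (allSubsets v) (λ T → w T * ⟦ T ⊆ᵇ Q ⟧))
flags {v} B w = begin
  ∑ (allSubsets v) (λ T → w T * count (λ Q → B Q ∧ T ⊆ᵇ Q) (allSubsets v))
    ≡⟨ ∑-cong (allSubsets v) (λ T → trans (cong (w T *_) (count≡∑ _ (allSubsets v))) (sym (∑-*ˡ (allSubsets v) (w T) _))) ⟩
  ∑ (allSubsets v) (λ T → ∑ (allSubsets v) (λ Q → w T * ⟦ B Q ∧ T ⊆ᵇ Q ⟧))
    ≡⟨ ∑-swap (allSubsets v) (allSubsets v) _ ⟩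
  ∑ (allSubsets v) (λ Q → ∑ (allSubsets v) (λ T → w T * ⟦ B Q ∧ T ⊆ᵇ Q ⟧))
    ≡⟨ ∑-cong (allSubsets v) (λ Q → trans (∑-cong (allSubsets v) (λ T → trans (cong (w T *_) (⟦∧⟧ (B Q) _))
                                                                         (*-left-comm (w T) ⟦ B Q ⟧ _)))
                                          (∑-*ˡ (allSubsets v) ⟦ B Q ⟧ _)) ⟩
  ∑ (allSubsets v) (λ Q → ⟦ B Q ⟧ * ∑ (allSubsets v) (λ T → w T * ⟦ T ⊆ᵇ Q ⟧)) ∎

design-flags : {t v k lam : ℕ} (B : BlockSet v) → IsDesign t v k lam B → (u : Subset v → ℕ) →
  ∑ (allSubsets v) (λ T → ⟦ ∣ T ∣ ≡ᵇ t ⟧ * u T * count (λ Q → B Q ∧ T ⊆ᵇ Q) (allSubsets v))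
  ≡ lam * ∑ (allSubsets v) (λ T → ⟦ ∣ T ∣ ≡ᵇ t ⟧ * u T)
design-flags {t} {v} {lam = lam} B (_ , λ-fold) u = trans (∑-cong (allSubsets v) term) (∑-*ˡ (allSubsets v) lam _)
  where
  term : ∀ T → ⟦ ∣ T ∣ ≡ᵇ t ⟧ * u T * count (λ Q → B Q ∧ T ⊆ᵇ Q) (allSubsets v) ≡ lam * (⟦ ∣ T ∣ ≡ᵇ t ⟧ * u T)
  term T = trans (*-assoc ⟦ ∣ T ∣ ≡ᵇ t ⟧ _ _)
    (trans (⟦⟧*-cong (∣ T ∣ ≡ᵇ t) (λ e → trans (cong (u T *_) (λ-fold T (≡ᵇ-sound _ _ e))) (*-comm (u T) lam)))
           (*-left-comm ⟦ ∣ T ∣ ≡ᵇ t ⟧ lam (u T)))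

BlockSize : (v k : ℕ) → BlockSet v → Set
BlockSize v k B = (Q : Subset v) → B Q ≡ true → ∣ Q ∣ ≡ k

replication : {v : ℕ} → BlockSet v → Fin v → ℕ
replication {v} B x = ∑ (allSubsets v) (λ Q → ⟦ B Q ⟧ * ⟦ lookup Q x ⟧)

-- Counting the flags x ∈ T ⊆ Q with |T| = s+1 and Q a block in two ways:
-- r(x) · C(k-1, s) = λ · C(v-1, s).
replication-equation : {s v k lam : ℕ} (B : BlockSet v) → IsDesign (suc s) v k lam B → (x : Fin v) →
  replication B x * ((k ∸ 1) C s) ≡ lam * ((v ∸ 1) C s)
replication-equation {s} {v} {k} {lam} B design@(blockSize , _) x = begin
  replication B x * ((k ∸ 1) C s)
    ≡⟨ trans (*-comm (replication B x) _) (sym (∑-*ˡ (allSubsets v) ((k ∸ 1) C s) _)) ⟩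
  ∑ (allSubsets v) (λ Q → ((k ∸ 1) C s) * (⟦ B Q ⟧ * ⟦ lookup Q x ⟧))
    ≡⟨ ∑-cong (allSubsets v) (λ Q → sym (perBlock Q)) ⟩
  ∑ (allSubsets v) (λ Q → ⟦ B Q ⟧ * ∑ (allSubsets v) (λ T → ⟦ ∣ T ∣ ≡ᵇ suc s ⟧ * ⟦ lookup T x ⟧ * ⟦ T ⊆ᵇ Q ⟧))
    ≡⟨ sym (flags B (λ T → ⟦ ∣ T ∣ ≡ᵇ suc s ⟧ * ⟦ lookup T x ⟧)) ⟩
  ∑ (allSubsets v) (λ T → ⟦ ∣ T ∣ ≡ᵇ suc s ⟧ * ⟦ lookup T x ⟧ * count (λ Q → B Q ∧ T ⊆ᵇ Q) (allSubsets v))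
    ≡⟨ design-flags B design (λ T → ⟦ lookup T x ⟧) ⟩
  lam * ∑ (allSubsets v) (λ T → ⟦ ∣ T ∣ ≡ᵇ suc s ⟧ * ⟦ lookup T x ⟧)
    ≡⟨ cong (lam *_) (trans (∑-cong (allSubsets v) (λ T → cong (⟦ ∣ T ∣ ≡ᵇ suc s ⟧ *_) (inAll T))) (subsetsThrough≡C ⊤ x s)) ⟩
  lam * (⟦ lookup ⊤ x ⟧ * ((∣ ⊤ {v} ∣ ∸ 1) C s))
    ≡⟨ cong (λ n → lam * (⟦ lookup ⊤ x ⟧ * ((n ∸ 1) C s))) (∣⊤∣≡n v) ⟩
  lam * (⟦ lookup (⊤ {v}) x ⟧ * ((v ∸ 1) C s))
    ≡⟨ cong (λ b → lam * (⟦ b ⟧ * ((v ∸ 1) C s))) (lookup-replicate x inside) ⟩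
  lam * (1 * ((v ∸ 1) C s))
    ≡⟨ cong (lam *_) (*-identityˡ _) ⟩
  lam * ((v ∸ 1) C s) ∎
  where
  inAll : ∀ T → ⟦ lookup T x ⟧ ≡ ⟦ lookup T x ⟧ * ⟦ T ⊆ᵇ ⊤ ⟧
  inAll T = trans (sym (*-identityʳ _)) (cong (λ b → ⟦ lookup T x ⟧ * ⟦ b ⟧) (sym (⊆ᵇ⊤ T)))
  perBlock : ∀ Q → ⟦ B Q ⟧ * ∑ (allSubsets v) (λ T → ⟦ ∣ T ∣ ≡ᵇ suc s ⟧ * ⟦ lookup T x ⟧ * ⟦ T ⊆ᵇ Q ⟧)
                   ≡ ((k ∸ 1) C s) * (⟦ B Q ⟧ * ⟦ lookup Q x ⟧)
  perBlock Q = begin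
    ⟦ B Q ⟧ * ∑ (allSubsets v) (λ T → ⟦ ∣ T ∣ ≡ᵇ suc s ⟧ * ⟦ lookup T x ⟧ * ⟦ T ⊆ᵇ Q ⟧)
      ≡⟨ cong (⟦ B Q ⟧ *_) (trans (∑-cong (allSubsets v) (λ T → *-assoc ⟦ ∣ T ∣ ≡ᵇ suc s ⟧ _ _)) (subsetsThrough≡C Q x s)) ⟩
    ⟦ B Q ⟧ * (⟦ lookup Q x ⟧ * ((∣ Q ∣ ∸ 1) C s))
      ≡⟨ ⟦⟧*-cong (B Q) (λ e → cong (λ n → ⟦ lookup Q x ⟧ * ((n ∸ 1) C s)) (blockSize Q e)) ⟩
    ⟦ B Q ⟧ * (⟦ lookup Q x ⟧ * ((k ∸ 1) C s))
      ≡⟨ trans (cong (⟦ B Q ⟧ *_) (*-comm ⟦ lookup Q x ⟧ _)) (*-left-comm ⟦ B Q ⟧ ((k ∸ 1) C s) _) ⟩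
    ((k ∸ 1) C s) * (⟦ B Q ⟧ * ⟦ lookup Q x ⟧) ∎

replication-constant : {t v k lam : ℕ} (B : BlockSet v) → 1 ≤ t → t ≤ k → IsDesign t v k lam B →
  (x y : Fin v) → replication B x ≡ replication B y
replication-constant {suc s} {v} {k} B (s≤s z≤n) s+1≤k design x y =
  *-cancelʳ-≡ _ _ ((k ∸ 1) C s) {{>-nonZero (C-pos (k ∸ 1) s (∸-monoˡ-≤ 1 s+1≤k))}}
    (trans (replication-equation B design x) (sym (replication-equation B design y)))

separating : {v : ℕ} → BlockSet v → Fin v → Fin v → ℕ
separating {v} B q p = ∑ (allSubsets v) (λ Q → ⟦ B Q ⟧ * (⟦ lookup Q q ⟧ * ⟦ not (lookup Q p) ⟧))

covering : {v : ℕ} → BlockSet v → Fin v → Fin v → ℕ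
covering {v} B q p = ∑ (allSubsets v) (λ Q → ⟦ B Q ⟧ * (⟦ lookup Q q ⟧ * ⟦ lookup Q p ⟧))

separating+covering : {v : ℕ} (B : BlockSet v) (q p : Fin v) → separating B q p + covering B q p ≡ replication B q
separating+covering {v} B q p = trans (sym (∑-+ (allSubsets v) _ _)) (∑-cong (allSubsets v) perBlock)
  where
  perBlock : ∀ Q → ⟦ B Q ⟧ * (⟦ lookup Q q ⟧ * ⟦ not (lookup Q p) ⟧) + ⟦ B Q ⟧ * (⟦ lookup Q q ⟧ * ⟦ lookup Q p ⟧)
                   ≡ ⟦ B Q ⟧ * ⟦ lookup Q q ⟧
  perBlock Q = begin
    ⟦ B Q ⟧ * (⟦ lookup Q q ⟧ * ⟦ not (lookup Q p) ⟧) + ⟦ B Q ⟧ * (⟦ lookup Q q ⟧ * ⟦ lookup Q p ⟧)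
      ≡⟨ sym (*-distribˡ-+ ⟦ B Q ⟧ _ _) ⟩
    ⟦ B Q ⟧ * (⟦ lookup Q q ⟧ * ⟦ not (lookup Q p) ⟧ + ⟦ lookup Q q ⟧ * ⟦ lookup Q p ⟧)
      ≡⟨ cong (⟦ B Q ⟧ *_) (sym (*-distribˡ-+ ⟦ lookup Q q ⟧ _ _)) ⟩
    ⟦ B Q ⟧ * (⟦ lookup Q q ⟧ * (⟦ not (lookup Q p) ⟧ + ⟦ lookup Q p ⟧))
      ≡⟨ cong (λ n → ⟦ B Q ⟧ * (⟦ lookup Q q ⟧ * n)) (⟦not⟧ (lookup Q p)) ⟩
    ⟦ B Q ⟧ * (⟦ lookup Q q ⟧ * 1)
      ≡⟨ cong (⟦ B Q ⟧ *_) (*-identityʳ _) ⟩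
    ⟦ B Q ⟧ * ⟦ lookup Q q ⟧ ∎

separating-sym : {v : ℕ} (B : BlockSet v) → (∀ x y → replication B x ≡ replication B y) →
  (q p : Fin v) → separating B q p ≡ separating B p q
separating-sym {v} B constant q p = +-cancelʳ-≡ (covering B q p) _ _ (begin
  separating B q p + covering B q p  ≡⟨ separating+covering B q p ⟩
  replication B q                    ≡⟨ constant q p ⟩
  replication B p                    ≡⟨ sym (separating+covering B p q) ⟩
  separating B p q + covering B p q  ≡⟨ cong (separating B p q +_) covering-sym ⟩
  separating B p q + covering B q p  ∎)
  where
  covering-sym : covering B p q ≡ covering B q p
  covering-sym = ∑-cong (allSubsets v) (λ Q → cong (⟦ B Q ⟧ *_) (*-comm ⟦ lookup Q p ⟧ _))

separating-diag : {v : ℕ} (B : BlockSet v) (q : Fin v) → separating B q q ≡ 0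
separating-diag {v} B q = ∑-zero (allSubsets v) _ perBlock
  where
  perBlock : ∀ Q → ⟦ B Q ⟧ * (⟦ lookup Q q ⟧ * ⟦ not (lookup Q q) ⟧) ≡ 0
  perBlock Q with lookup Q q
  ... | true = *-zeroʳ ⟦ B Q ⟧
  ... | false = *-zeroʳ ⟦ B Q ⟧

-- Every block Q contributes |Q| (v - |Q|) separated ordered pairs.
∑-separating : {v : ℕ} (k : ℕ) (B : BlockSet v) → BlockSize v k B →
  ∑² (λ p q → separating B q p) ≡ numBlocks B * k * (v ∸ k)
∑-separating {v} k B blockSize = begin
  ∑² (λ p q → separating B q p)
    ≡⟨ ∑-swap (allFin v) (allFin v) _ ⟩
  ∑² (λ q p → separating B q p)
    ≡⟨ ∑-cong (allFin v) (λ q → ∑-swap (allFin v) (allSubsets v) _) ⟩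
  ∑ (allFin v) (λ q → ∑ (allSubsets v) (λ Q → ∑ (allFin v) (λ p → ⟦ B Q ⟧ * (⟦ lookup Q q ⟧ * ⟦ not (lookup Q p) ⟧))))
    ≡⟨ ∑-swap (allFin v) (allSubsets v) _ ⟩
  ∑ (allSubsets v) (λ Q → ∑² (λ q p → ⟦ B Q ⟧ * (⟦ lookup Q q ⟧ * ⟦ not (lookup Q p) ⟧)))
    ≡⟨ ∑-cong (allSubsets v) perBlock ⟩
  ∑ (allSubsets v) (λ Q → k * (v ∸ k) * ⟦ B Q ⟧)
    ≡⟨ ∑-*ˡ (allSubsets v) (k * (v ∸ k)) _ ⟩
  k * (v ∸ k) * ∑ (allSubsets v) (λ Q → ⟦ B Q ⟧)
    ≡⟨ cong (k * (v ∸ k) *_) (sym (count≡∑ B (allSubsets v))) ⟩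
  k * (v ∸ k) * numBlocks B
    ≡⟨ trans (*-comm (k * (v ∸ k)) _) (sym (*-assoc (numBlocks B) k (v ∸ k))) ⟩
  numBlocks B * k * (v ∸ k) ∎
  where
  perBlock : ∀ Q → ∑² (λ q p → ⟦ B Q ⟧ * (⟦ lookup Q q ⟧ * ⟦ not (lookup Q p) ⟧)) ≡ k * (v ∸ k) * ⟦ B Q ⟧
  perBlock Q with B Q in isBlock
  ... | false = trans (∑-zero (allFin v) _ (λ q → ∑-zero (allFin v) _ (λ p → refl))) (sym (*-zeroʳ (k * (v ∸ k))))
  ... | true = begin
    ∑² (λ q p → 1 * (⟦ lookup Q q ⟧ * ⟦ not (lookup Q p) ⟧))
      ≡⟨ ∑²-cong {v} (λ q p → *-identityˡ (⟦ lookup Q q ⟧ * ⟦ not (lookup Q p) ⟧)) ⟩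
    ∑ (allFin v) (λ q → ∑ (allFin v) (λ p → ⟦ lookup Q q ⟧ * ⟦ not (lookup Q p) ⟧))
      ≡⟨ ∑-cong (allFin v) (λ q → ∑-*ˡ (allFin v) ⟦ lookup Q q ⟧ _) ⟩
    ∑ (allFin v) (λ q → ⟦ lookup Q q ⟧ * ∑ (allFin v) (λ p → ⟦ not (lookup Q p) ⟧))
      ≡⟨ ∑-cong (allFin v) (λ q → cong (⟦ lookup Q q ⟧ *_) (∑-complement Q (blockSize Q isBlock))) ⟩
    ∑ (allFin v) (λ q → ⟦ lookup Q q ⟧ * (v ∸ k))
      ≡⟨ trans (∑-cong (allFin v) (λ q → *-comm ⟦ lookup Q q ⟧ (v ∸ k))) (∑-*ˡ (allFin v) (v ∸ k) _) ⟩
    (v ∸ k) * ∑ (allFin v) (λ q → ⟦ lookup Q q ⟧)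
      ≡⟨ cong ((v ∸ k) *_) (trans (sym (∣∣≡∑ Q)) (blockSize Q isBlock)) ⟩
    (v ∸ k) * k
      ≡⟨ trans (*-comm (v ∸ k) k) (sym (*-identityʳ _)) ⟩
    k * (v ∸ k) * 1 ∎

-- Number of edges of Γ_{v,k} entering a block: each block Q is entered once per entering pair.
edgesIntoBlocks : {v : ℕ} → BlockSet v → ℕ
edgesIntoBlocks {v} B = ∑ (allSubsets v) (λ Q → ⟦ B Q ⟧ * ∑² (λ p q → ⟦ entering? Q p q ⟧))

-- Grouping the entering pairs by the pair of points: Σ_{q<p} c(q,p).
edgesIntoBlocks≡∑separating : {v : ℕ} (B : BlockSet v) →
  edgesIntoBlocks B ≡ ∑² (λ p q → ⟦ toℕ q <ᵇ toℕ p ⟧ * separating B q p)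
edgesIntoBlocks≡∑separating {v} B =
  trans (∑-∑²-swap (allSubsets v) (λ Q → ⟦ B Q ⟧) (λ Q p q → ⟦ entering? Q p q ⟧))
        (∑²-cong (λ p q → trans (∑-cong (allSubsets v) (perBlock p q)) (∑-*ˡ (allSubsets v) ⟦ toℕ q <ᵇ toℕ p ⟧ _)))
  where
  perBlock : ∀ p q Q → ⟦ B Q ⟧ * ⟦ entering? Q p q ⟧ ≡ ⟦ toℕ q <ᵇ toℕ p ⟧ * (⟦ B Q ⟧ * (⟦ lookup Q q ⟧ * ⟦ not (lookup Q p) ⟧))
  perBlock p q Q = begin
    ⟦ B Q ⟧ * ⟦ entering? Q p q ⟧
      ≡⟨ cong (⟦ B Q ⟧ *_) (trans (⟦∧⟧ (toℕ q <ᵇ toℕ p) _) (cong (⟦ toℕ q <ᵇ toℕ p ⟧ *_) (⟦∧⟧ (lookup Q q) _))) ⟩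
    ⟦ B Q ⟧ * (⟦ toℕ q <ᵇ toℕ p ⟧ * (⟦ lookup Q q ⟧ * ⟦ not (lookup Q p) ⟧))
      ≡⟨ *-left-comm ⟦ B Q ⟧ ⟦ toℕ q <ᵇ toℕ p ⟧ _ ⟩
    ⟦ toℕ q <ᵇ toℕ p ⟧ * (⟦ B Q ⟧ * (⟦ lookup Q q ⟧ * ⟦ not (lookup Q p) ⟧)) ∎

-- Since c is symmetric for t ≥ 1, twice the edges into blocks is Σ_{q≠p} c(q,p) = λ₀ k (v - k).
twice-edgesIntoBlocks : {t v k lam : ℕ} (B : BlockSet v) → 1 ≤ t → t ≤ k → IsDesign t v k lam B →
  2 * edgesIntoBlocks B ≡ numBlocks B * k * (v ∸ k)
twice-edgesIntoBlocks {v = v} {k} B 1≤t t≤k design@(blockSize , _) = begin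
  2 * edgesIntoBlocks B
    ≡⟨ cong (edgesIntoBlocks B +_) (+-identityʳ _) ⟩
  edgesIntoBlocks B + edgesIntoBlocks B
    ≡⟨ cong₂ _+_ (edgesIntoBlocks≡∑separating B) (trans (edgesIntoBlocks≡∑separating B) reversed) ⟩
  ∑² (λ p q → ⟦ toℕ q <ᵇ toℕ p ⟧ * separating B q p) + ∑² (λ p q → ⟦ toℕ p <ᵇ toℕ q ⟧ * separating B q p)
    ≡⟨ sym (∑-+ (allFin v) _ _) ⟩
  ∑ (allFin v) (λ p → ∑ (allFin v) (λ q → ⟦ toℕ q <ᵇ toℕ p ⟧ * separating B q p)
                     + ∑ (allFin v) (λ q → ⟦ toℕ p <ᵇ toℕ q ⟧ * separating B q p))
    ≡⟨ ∑-cong (allFin v) (λ p → trans (sym (∑-+ (allFin v) _ _)) (∑-cong (allFin v) (bothOrders p))) ⟩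
  ∑² (λ p q → separating B q p)
    ≡⟨ ∑-separating k B blockSize ⟩
  numBlocks B * k * (v ∸ k) ∎
  where
  reversed : ∑² (λ p q → ⟦ toℕ q <ᵇ toℕ p ⟧ * separating B q p) ≡ ∑² (λ p q → ⟦ toℕ p <ᵇ toℕ q ⟧ * separating B q p)
  reversed = trans (∑²-cong (λ p q → cong (⟦ toℕ q <ᵇ toℕ p ⟧ *_)
                     (separating-sym B (replication-constant B 1≤t t≤k design) q p)))
                   (∑-swap (allFin v) (allFin v) _)
  bothOrders : ∀ p q → ⟦ toℕ q <ᵇ toℕ p ⟧ * separating B q p + ⟦ toℕ p <ᵇ toℕ q ⟧ * separating B q p ≡ separating B q p
  bothOrders p q with q FinP.≟ p
  ... | yes refl rewrite separating-diag B q | *-zeroʳ ⟦ toℕ q <ᵇ toℕ q ⟧ = refl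
  ... | no q≢p = trans (sym (*-distribʳ-+ (separating B q p) ⟦ toℕ q <ᵇ toℕ p ⟧ _))
                       (trans (cong (_* separating B q p) (⟦<ᵇ⟧+⟦>ᵇ⟧ (toℕ q) (toℕ p) (q≢p ∘ FinP.toℕ-injective)))
                              (*-identityˡ _))

∑-upTo-suc : (n : ℕ) (f : ℕ → ℕ) → ∑ (upTo (suc n)) f ≡ ∑ (upTo n) f + f n
∑-upTo-suc n f = begin
  ∑ (upTo (suc n)) f            ≡⟨ cong (λ l → ∑ l f) (sym (ListP.upTo-∷ʳ n)) ⟩
  ∑ (upTo n ++ n ∷ []) f        ≡⟨ ∑-++ (upTo n) (n ∷ []) f ⟩
  ∑ (upTo n) f + (f n + 0)      ≡⟨ cong (∑ (upTo n) f +_) (+-identityʳ (f n)) ⟩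
  ∑ (upTo n) f + f n            ∎

∑-upTo-vanish : (d n : ℕ) (f : ℕ → ℕ) → (∀ i → i ≢ d → f i ≡ 0) → n ≤ d → ∑ (upTo n) f ≡ 0
∑-upTo-vanish d zero f off _ = refl
∑-upTo-vanish d (suc n) f off n<d = begin
  ∑ (upTo (suc n)) f  ≡⟨ ∑-upTo-suc n f ⟩
  ∑ (upTo n) f + f n  ≡⟨ cong₂ _+_ (∑-upTo-vanish d n f off (<⇒≤ n<d)) (off n (<⇒≢ n<d)) ⟩
  0                   ∎

∑-upTo-single : (d n : ℕ) (f : ℕ → ℕ) → (∀ i → i ≢ d → f i ≡ 0) → d < n → ∑ (upTo n) f ≡ f d
∑-upTo-single d (suc n) f off d<n with d ≟ n
... | yes refl = trans (∑-upTo-suc n f) (cong (_+ f d) (∑-upTo-vanish d n f off ≤-refl))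
... | no d≢n = trans (∑-upTo-suc n f) (trans (cong₂ _+_ (∑-upTo-single d n f off (≤∧≢⇒< (≤-pred d<n) d≢n)) (off n (d≢n ∘ sym)))
                                             (+-identityʳ (f d)))

∑-index : (d k : ℕ) → d ≤ k → ∑ (upTo (suc k)) (λ i → i * ⟦ d ≡ᵇ i ⟧) ≡ d
∑-index d k d≤k = trans (∑-upTo-single d (suc k) _ off (s≤s d≤k)) (trans (cong (d *_) (⟦≡ᵇ⟧-refl d d refl)) (*-identityʳ d))
  where
  off : ∀ i → i ≢ d → i * ⟦ d ≡ᵇ i ⟧ ≡ 0
  off i i≢d with d ≡ᵇ i in e
  ... | false = *-zeroʳ i
  ... | true = ⊥-elim (i≢d (sym (≡ᵇ-sound d i e)))

-- |N⁺(P) ∩ 𝓑| as a sum over all subsets (blocks are k-sets, so the size filter is redundant).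
outBlocks≡∑ : {v : ℕ} (k : ℕ) (B : BlockSet v) → BlockSize v k B → (P : Subset v) →
  outBlocks v k B P ≡ ∑ (allSubsets v) (λ Q → ⟦ B Q ⟧ * ⟦ edge P Q ⟧)
outBlocks≡∑ {v} k B blockSize P =
  trans (count≡∑ _ (kSubsets v k)) (trans (∑-filter _ (allSubsets v) _) (∑-cong (allSubsets v) term))
  where
  term : ∀ Q → ⟦ ∣ Q ∣ ≡ᵇ k ⟧ * ⟦ edge P Q ∧ B Q ⟧ ≡ ⟦ B Q ⟧ * ⟦ edge P Q ⟧
  term Q with B Q in isBlock
  ... | false rewrite BoolP.∧-zeroʳ (edge P Q) = *-zeroʳ ⟦ ∣ Q ∣ ≡ᵇ k ⟧
  ... | true rewrite BoolP.∧-identityʳ (edge P Q) | ⟦≡ᵇ⟧-refl _ _ (blockSize Q isBlock) = refl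

outBlocks-block : {v : ℕ} (k : ℕ) (B : BlockSet v) → BlockSize v k B → Independent v k B → (P : Subset v) →
  ∣ P ∣ ≡ k → B P ≡ true → outBlocks v k B P ≡ 0
outBlocks-block {v} k B blockSize indep P ∣P∣≡k isBlock = trans (outBlocks≡∑ k B blockSize P) (∑-zero (allSubsets v) _ term)
  where
  term : ∀ Q → ⟦ B Q ⟧ * ⟦ edge P Q ⟧ ≡ 0
  term Q with B Q in isBlock'
  ... | false = refl
  ... | true rewrite indep P Q ∣P∣≡k (blockSize Q isBlock') isBlock isBlock' = refl

outBlocks≤k : {v : ℕ} (k : ℕ) (B : BlockSet v) → BlockSize v k B → Independent v k B → (P : Subset v) →
  ∣ P ∣ ≡ k → outBlocks v k B P ≤ k
outBlocks≤k k B blockSize indep P ∣P∣≡k =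
  subst (_≤ k) (sym (outBlocks≡∑ k B blockSize P)) (blocks-reached≤k k B indep P ∣P∣≡k)

edgesFromNonBlocks : (v k : ℕ) → BlockSet v → ℕ
edgesFromNonBlocks v k B = ∑ (kSubsets v k) (λ P → ⟦ not (B P) ⟧ * outBlocks v k B P)

-- Σ_i i·a_i counts these edges: a non-block with i out-neighbours in 𝓑 is counted in a_i (i ≤ k).
weightedSum≡edgesFromNonBlocks : {v : ℕ} (k : ℕ) (B : BlockSet v) → BlockSize v k B → Independent v k B →
  weightedSum v k B ≡ edgesFromNonBlocks v k B
weightedSum≡edgesFromNonBlocks {v} k B blockSize indep = begin
  ∑ (upTo (suc k)) (λ i → i * a v k B i)
    ≡⟨ ∑-cong (upTo (suc k)) (λ i → cong (i *_) (trans (count≡∑ _ (kSubsets v k)) (∑-filter _ (allSubsets v) _))) ⟩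
  ∑ (upTo (suc k)) (λ i → i * ∑ (allSubsets v) (λ P → ⟦ ∣ P ∣ ≡ᵇ k ⟧ * ⟦ not (B P) ∧ (outBlocks v k B P ≡ᵇ i) ⟧))
    ≡⟨ ∑-cong (upTo (suc k)) (λ i → sym (∑-*ˡ (allSubsets v) i _)) ⟩
  ∑ (upTo (suc k)) (λ i → ∑ (allSubsets v) (λ P → i * (⟦ ∣ P ∣ ≡ᵇ k ⟧ * ⟦ not (B P) ∧ (outBlocks v k B P ≡ᵇ i) ⟧)))
    ≡⟨ ∑-swap (upTo (suc k)) (allSubsets v) _ ⟩
  ∑ (allSubsets v) (λ P → ∑ (upTo (suc k)) (λ i → i * (⟦ ∣ P ∣ ≡ᵇ k ⟧ * ⟦ not (B P) ∧ (outBlocks v k B P ≡ᵇ i) ⟧)))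
    ≡⟨ ∑-cong (allSubsets v) perSet ⟩
  ∑ (allSubsets v) (λ P → ⟦ ∣ P ∣ ≡ᵇ k ⟧ * (⟦ not (B P) ⟧ * outBlocks v k B P))
    ≡⟨ sym (∑-filter _ (allSubsets v) _) ⟩
  edgesFromNonBlocks v k B ∎
  where
  perSet : ∀ P → ∑ (upTo (suc k)) (λ i → i * (⟦ ∣ P ∣ ≡ᵇ k ⟧ * ⟦ not (B P) ∧ (outBlocks v k B P ≡ᵇ i) ⟧))
                 ≡ ⟦ ∣ P ∣ ≡ᵇ k ⟧ * (⟦ not (B P) ⟧ * outBlocks v k B P)
  perSet P = begin
    ∑ (upTo (suc k)) (λ i → i * (⟦ ∣ P ∣ ≡ᵇ k ⟧ * ⟦ not (B P) ∧ (outBlocks v k B P ≡ᵇ i) ⟧))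
      ≡⟨ ∑-cong (upTo (suc k)) (λ i → trans (cong (λ n → i * (⟦ ∣ P ∣ ≡ᵇ k ⟧ * n)) (⟦∧⟧ (not (B P)) _)) (regroup i)) ⟩
    ∑ (upTo (suc k)) (λ i → ⟦ ∣ P ∣ ≡ᵇ k ⟧ * (⟦ not (B P) ⟧ * (i * ⟦ outBlocks v k B P ≡ᵇ i ⟧)))
      ≡⟨ ∑-*ˡ (upTo (suc k)) ⟦ ∣ P ∣ ≡ᵇ k ⟧ _ ⟩
    ⟦ ∣ P ∣ ≡ᵇ k ⟧ * ∑ (upTo (suc k)) (λ i → ⟦ not (B P) ⟧ * (i * ⟦ outBlocks v k B P ≡ᵇ i ⟧))
      ≡⟨ ⟦⟧*-cong (∣ P ∣ ≡ᵇ k) (λ e → trans (∑-*ˡ (upTo (suc k)) ⟦ not (B P) ⟧ _)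
                                      (cong (⟦ not (B P) ⟧ *_) (∑-index _ k (outBlocks≤k k B blockSize indep P (≡ᵇ-sound _ _ e))))) ⟩
    ⟦ ∣ P ∣ ≡ᵇ k ⟧ * (⟦ not (B P) ⟧ * outBlocks v k B P) ∎
    where
    regroup : ∀ i → i * (⟦ ∣ P ∣ ≡ᵇ k ⟧ * (⟦ not (B P) ⟧ * ⟦ outBlocks v k B P ≡ᵇ i ⟧))
                    ≡ ⟦ ∣ P ∣ ≡ᵇ k ⟧ * (⟦ not (B P) ⟧ * (i * ⟦ outBlocks v k B P ≡ᵇ i ⟧))
    regroup i = trans (*-left-comm i ⟦ ∣ P ∣ ≡ᵇ k ⟧ _) (cong (⟦ ∣ P ∣ ≡ᵇ k ⟧ *_) (*-left-comm i ⟦ not (B P) ⟧ _))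

-- For independent 𝓑 every edge into a block starts at a non-block.
edgesFromNonBlocks≡edgesIntoBlocks : {v : ℕ} (k : ℕ) (B : BlockSet v) → BlockSize v k B → Independent v k B →
  edgesFromNonBlocks v k B ≡ edgesIntoBlocks B
edgesFromNonBlocks≡edgesIntoBlocks {v} k B blockSize indep = begin
  edgesFromNonBlocks v k B
    ≡⟨ ∑-filter _ (allSubsets v) _ ⟩
  ∑ (allSubsets v) (λ P → ⟦ ∣ P ∣ ≡ᵇ k ⟧ * (⟦ not (B P) ⟧ * outBlocks v k B P))
    ≡⟨ ∑-cong (allSubsets v) fromNonBlock ⟩
  ∑ (allSubsets v) (λ P → ∑ (allSubsets v) (λ Q → ⟦ ∣ P ∣ ≡ᵇ k ⟧ * (⟦ B Q ⟧ * ⟦ edge P Q ⟧)))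
    ≡⟨ ∑-swap (allSubsets v) (allSubsets v) _ ⟩
  ∑ (allSubsets v) (λ Q → ∑ (allSubsets v) (λ P → ⟦ ∣ P ∣ ≡ᵇ k ⟧ * (⟦ B Q ⟧ * ⟦ edge P Q ⟧)))
    ≡⟨ ∑-cong (allSubsets v) intoBlock ⟩
  edgesIntoBlocks B ∎
  where
  fromNonBlock : ∀ P → ⟦ ∣ P ∣ ≡ᵇ k ⟧ * (⟦ not (B P) ⟧ * outBlocks v k B P)
                       ≡ ∑ (allSubsets v) (λ Q → ⟦ ∣ P ∣ ≡ᵇ k ⟧ * (⟦ B Q ⟧ * ⟦ edge P Q ⟧))
  fromNonBlock P = trans (⟦⟧*-cong (∣ P ∣ ≡ᵇ k) (λ e → trans (byBlock (B P) refl e) (outBlocks≡∑ k B blockSize P)))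
                         (sym (∑-*ˡ (allSubsets v) ⟦ ∣ P ∣ ≡ᵇ k ⟧ _))
    where
    byBlock : ∀ b → B P ≡ b → (∣ P ∣ ≡ᵇ k) ≡ true → ⟦ not b ⟧ * outBlocks v k B P ≡ outBlocks v k B P
    byBlock false _ _ = +-identityʳ _
    byBlock true isBlock e = sym (outBlocks-block k B blockSize indep P (≡ᵇ-sound _ _ e) isBlock)
  intoBlock : ∀ Q → ∑ (allSubsets v) (λ P → ⟦ ∣ P ∣ ≡ᵇ k ⟧ * (⟦ B Q ⟧ * ⟦ edge P Q ⟧))
                    ≡ ⟦ B Q ⟧ * ∑² (λ p q → ⟦ entering? Q p q ⟧)
  intoBlock Q = begin
    ∑ (allSubsets v) (λ P → ⟦ ∣ P ∣ ≡ᵇ k ⟧ * (⟦ B Q ⟧ * ⟦ edge P Q ⟧))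
      ≡⟨ ∑-cong (allSubsets v) (λ P → *-left-comm ⟦ ∣ P ∣ ≡ᵇ k ⟧ ⟦ B Q ⟧ _) ⟩
    ∑ (allSubsets v) (λ P → ⟦ B Q ⟧ * (⟦ ∣ P ∣ ≡ᵇ k ⟧ * ⟦ edge P Q ⟧))
      ≡⟨ ∑-*ˡ (allSubsets v) ⟦ B Q ⟧ _ ⟩
    ⟦ B Q ⟧ * ∑ (allSubsets v) (λ P → ⟦ ∣ P ∣ ≡ᵇ k ⟧ * ⟦ edge P Q ⟧)
      ≡⟨ ⟦⟧*-cong (B Q) (λ isBlock → in-degree k Q (blockSize Q isBlock)) ⟩
    ⟦ B Q ⟧ * ∑² (λ p q → ⟦ entering? Q p q ⟧) ∎

part1 : {t v k lam : ℕ} (B : BlockSet v) → 1 ≤ t → t ≤ k → IsDesign t v k lam B → Independent v k B →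
  2 * weightedSum v k B ≡ numBlocks B * k * (v ∸ k)
part1 {k = k} B 1≤t t≤k design@(blockSize , _) indep = begin
  2 * weightedSum _ k B          ≡⟨ cong (2 *_) (weightedSum≡edgesFromNonBlocks k B blockSize indep) ⟩
  2 * edgesFromNonBlocks _ k B   ≡⟨ cong (2 *_) (edgesFromNonBlocks≡edgesIntoBlocks k B blockSize indep) ⟩
  2 * edgesIntoBlocks B          ≡⟨ twice-edgesIntoBlocks B 1≤t t≤k design ⟩
  numBlocks B * k * (_ ∸ k)      ∎

module _ {v : ℕ} {P Q : Subset v} {p q : Fin v} (m : Move P Q p q) where

  move-distinct : P ≢ Q
  move-distinct P≡Q = true≢false (begin
    true                    ≡⟨ sym (Move.p∈P m) ⟩
    lookup P p              ≡⟨ cong (λ R → lookup R p) (trans P≡Q (Move.Q≡ m)) ⟩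
    lookup (swap P p q) p   ≡⟨ swap-p P p q (<⇒≢ᶠ (Move.q<p m)) ⟩
    false                   ∎)

  ∣move-common∣ : ∣ P [ p ]≔ outside ∣ + 1 ≡ ∣ P ∣
  ∣move-common∣ = begin
    ∣ P [ p ]≔ outside ∣ + 1                ≡⟨ cong (λ b → ∣ P [ p ]≔ outside ∣ + ⟦ b ⟧) (sym (Move.p∈P m)) ⟩
    ∣ P [ p ]≔ outside ∣ + ⟦ lookup P p ⟧   ≡⟨ ∣[]≔∣ P p outside ⟩
    ∣ P ∣ + 0                               ≡⟨ +-identityʳ _ ⟩
    ∣ P ∣                                   ∎

  move-common⊆source : (P [ p ]≔ outside) ⊆ᵇ P ≡ true
  move-common⊆source = ⊆ᵇ-complete _ P inP
    where
    inP : ∀ i → lookup (P [ p ]≔ outside) i ≡ true → lookup P i ≡ true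
    inP i i∈ with i FinP.≟ p
    ... | yes refl = ⊥-elim (true≢false (trans (sym i∈) (lookup∘update p P outside)))
    ... | no i≢p = trans (sym (lookup∘update′ i≢p P outside)) i∈

  move-common⊆target : (P [ p ]≔ outside) ⊆ᵇ Q ≡ true
  move-common⊆target = ⊆ᵇ-complete _ Q inQ
    where
    inQ : ∀ i → lookup (P [ p ]≔ outside) i ≡ true → lookup Q i ≡ true
    inQ i i∈ with i FinP.≟ q
    ... | yes refl = trans (cong (λ R → lookup R q) (Move.Q≡ m)) (swap-q P p q)
    ... | no i≢q = trans (cong (λ R → lookup R i) (Move.Q≡ m)) (trans (lookup∘update′ i≢q (P [ p ]≔ outside) inside) i∈)

two-blocks : {v : ℕ} (B : BlockSet v) (T X Y : Subset v) → X ≢ Y → B X ≡ true → B Y ≡ true →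
  T ⊆ᵇ X ≡ true → T ⊆ᵇ Y ≡ true → 2 ≤ count (λ Z → B Z ∧ T ⊆ᵇ Z) (allSubsets v)
two-blocks {v} B T X Y X≢Y X∈B Y∈B T⊆X T⊆Y =
  subst (2 ≤_) (sym (count≡∑ _ (allSubsets v)))
    (subst (_≤ ∑ (allSubsets v) containsT) (trans (∑-+ (allSubsets v) _ _) (cong₂ _+_ (∑-is X) (∑-is Y)))
           (∑-mono (allSubsets v) pointwise))
  where
  containsT : Subset v → ℕ
  containsT Z = ⟦ B Z ∧ T ⊆ᵇ Z ⟧
  is : Subset v → Subset v → ℕ
  is Z W = ⟦ Z ≡ˢ? W ⟧
  ∑-is : ∀ W → ∑ (allSubsets v) (λ Z → is Z W) ≡ 1
  ∑-is W = trans (∑-allSubsets-single W _ (λ Z Z≢W → cong ⟦_⟧ (⌊⌋-false (≡-dec BoolP._≟_ Z W) Z≢W)))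
                 (cong ⟦_⟧ (⌊⌋-complete (≡-dec BoolP._≟_ W W) refl))
  containsT-pos : ∀ {W} → B W ≡ true → T ⊆ᵇ W ≡ true → 1 ≤ containsT W
  containsT-pos W∈B T⊆W rewrite W∈B | T⊆W = ≤-refl
  pointwise : ∀ Z → is Z X + is Z Y ≤ containsT Z
  pointwise Z with Z ≡ˢ? X in eX | Z ≡ˢ? Y in eY
  ... | false | false = z≤n
  ... | true | true = ⊥-elim (X≢Y (trans (sym (⌊⌋-sound (≡-dec BoolP._≟_ Z X) eX)) (⌊⌋-sound (≡-dec BoolP._≟_ Z Y) eY)))
  ... | true | false rewrite ⌊⌋-sound (≡-dec BoolP._≟_ Z X) eX = containsT-pos X∈B T⊆X
  ... | false | true rewrite ⌊⌋-sound (≡-dec BoolP._≟_ Z Y) eY = containsT-pos Y∈B T⊆Y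

-- In an S(2,3,v) adjacent blocks P → Q would both contain the pair P - p,
-- which lies in only one block.
sts-independent : {v : ℕ} (B : BlockSet v) → IsDesign 2 v 3 1 B → Independent v 3 B
sts-independent {v} B (_ , λ-fold) P Q ∣P∣≡3 _ P∈B Q∈B = ≢true⇒≡false noEdge
  where
  noEdge : edge P Q ≢ true
  noEdge e with edge-elim {P = P} {Q = Q} e
  ... | p , q , m = <-irrefl refl (≤-trans twoBlocks (≤-reflexive (λ-fold pair ∣pair∣≡2)))
    where
    pair = P [ p ]≔ outside
    twoBlocks : 2 ≤ count (λ Z → B Z ∧ pair ⊆ᵇ Z) (allSubsets v)
    twoBlocks = two-blocks B pair P Q (move-distinct m) P∈B Q∈B (move-common⊆source m) (move-common⊆target m)
    ∣pair∣≡2 : ∣ pair ∣ ≡ 2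
    ∣pair∣≡2 = +-cancelʳ-≡ 1 _ _ (trans (∣move-common∣ m) ∣P∣≡3)

∑-kSubsets-cong : {v : ℕ} (k : ℕ) {f g : Subset v → ℕ} → (∀ P → ∣ P ∣ ≡ k → f P ≡ g P) →
  ∑ (kSubsets v k) f ≡ ∑ (kSubsets v k) g
∑-kSubsets-cong {v} k {f} {g} agree = begin
  ∑ (kSubsets v k) f                             ≡⟨ ∑-filter _ (allSubsets v) f ⟩
  ∑ (allSubsets v) (λ P → ⟦ ∣ P ∣ ≡ᵇ k ⟧ * f P)   ≡⟨ ∑-cong (allSubsets v) (λ P → ⟦⟧*-cong (∣ P ∣ ≡ᵇ k) (λ e → agree P (≡ᵇ-sound _ _ e))) ⟩
  ∑ (allSubsets v) (λ P → ⟦ ∣ P ∣ ≡ᵇ k ⟧ * g P)   ≡⟨ sym (∑-filter _ (allSubsets v) g) ⟩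
  ∑ (kSubsets v k) g                             ∎

count-kSubsets : (v t : ℕ) → ∑ (kSubsets v t) (λ _ → 1) ≡ v C t
count-kSubsets v t = begin
  ∑ (kSubsets v t) (λ _ → 1)                        ≡⟨ ∑-filter _ (allSubsets v) _ ⟩
  ∑ (allSubsets v) (λ T → ⟦ ∣ T ∣ ≡ᵇ t ⟧ * 1)        ≡⟨ ∑-cong (allSubsets v) (λ T → cong (λ b → ⟦ ∣ T ∣ ≡ᵇ t ⟧ * ⟦ b ⟧) (sym (⊆ᵇ⊤ T))) ⟩
  subsets (⊤ {v}) t                                  ≡⟨ subsets≡C (⊤ {v}) t ⟩
  ∣ ⊤ {v} ∣ C t                                      ≡⟨ cong (_C t) (∣⊤∣≡n v) ⟩
  v C t                                              ∎

∑-pairs : {A : Set} (xs : List A) (g : A → ℕ) → (∀ x → g x ≤ 1) →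
  ∑ (pairs xs) (λ z → g (proj₁ z) * g (proj₂ z)) ≡ ∑ xs g C 2
∑-pairs [] g g≤1 = refl
∑-pairs (x ∷ xs) g g≤1 = begin
  ∑ (map (x ,_) xs ++ pairs xs) (λ z → g (proj₁ z) * g (proj₂ z))
    ≡⟨ ∑-++ (map (x ,_) xs) (pairs xs) _ ⟩
  ∑ (map (x ,_) xs) (λ z → g (proj₁ z) * g (proj₂ z)) + ∑ (pairs xs) (λ z → g (proj₁ z) * g (proj₂ z))
    ≡⟨ cong₂ _+_ (trans (∑-map (x ,_) xs _) (∑-*ˡ xs (g x) g)) (∑-pairs xs g g≤1) ⟩
  g x * ∑ xs g + ∑ xs g C 2
    ≡⟨ addPoint (g x) (g≤1 x) ⟩
  (g x + ∑ xs g) C 2 ∎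
  where
  addPoint : ∀ c → c ≤ 1 → c * ∑ xs g + ∑ xs g C 2 ≡ (c + ∑ xs g) C 2
  addPoint zero _ = refl
  addPoint (suc zero) _ = begin
    1 * ∑ xs g + ∑ xs g C 2    ≡⟨ cong (_+ ∑ xs g C 2) (trans (*-identityˡ _) (sym (nC1≡n (∑ xs g)))) ⟩
    ∑ xs g C 1 + ∑ xs g C 2    ≡⟨ nCk+nC[k+1]≡[n+1]C[k+1] (∑ xs g) 1 ⟩
    suc (∑ xs g) C 2           ∎
  addPoint (suc (suc c)) (s≤s ())

-- Σ_{B,C} I(B,C) = Σ_P C(|N⁺(P) ∩ 𝓑|, 2): a common in-neighbour P of two blocks
-- is counted once for each pair of blocks among its out-neighbours.
pairSumI≡∑C2 : {v : ℕ} (k : ℕ) (B : BlockSet v) → BlockSize v k B →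
  pairSumI v k B ≡ ∑ (kSubsets v k) (λ P → outBlocks v k B P C 2)
pairSumI≡∑C2 {v} k B blockSize = begin
  pairSumI v k B
    ≡⟨ ∑-cong (pairs (blockList B)) (λ z → trans (count≡∑ _ (kSubsets v k)) (∑-cong (kSubsets v k) (λ P → ⟦∧⟧ (edge P (proj₁ z)) _))) ⟩
  ∑ (pairs (blockList B)) (λ z → ∑ (kSubsets v k) (λ P → ⟦ edge P (proj₁ z) ⟧ * ⟦ edge P (proj₂ z) ⟧))
    ≡⟨ ∑-swap (pairs (blockList B)) (kSubsets v k) _ ⟩
  ∑ (kSubsets v k) (λ P → ∑ (pairs (blockList B)) (λ z → ⟦ edge P (proj₁ z) ⟧ * ⟦ edge P (proj₂ z) ⟧))
    ≡⟨ ∑-cong (kSubsets v k) (λ P → ∑-pairs (blockList B) (λ X → ⟦ edge P X ⟧) (λ X → ⟦⟧≤1 (edge P X))) ⟩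
  ∑ (kSubsets v k) (λ P → ∑ (blockList B) (λ X → ⟦ edge P X ⟧) C 2)
    ≡⟨ ∑-cong (kSubsets v k) (λ P → cong (_C 2) (trans (∑-filter B (allSubsets v) _) (sym (outBlocks≡∑ k B blockSize P)))) ⟩
  ∑ (kSubsets v k) (λ P → outBlocks v k B P C 2) ∎

a₀+a₃-pointwise : {v : ℕ} (B : BlockSet v) → BlockSize v 3 B → Independent v 3 B → (P : Subset v) → ∣ P ∣ ≡ 3 →
  ⟦ not (B P) ∧ (outBlocks v 3 B P ≡ᵇ 0) ⟧ + ⟦ not (B P) ∧ (outBlocks v 3 B P ≡ᵇ 3) ⟧ + ⟦ not (B P) ⟧ * outBlocks v 3 B P
  ≡ ⟦ not (B P) ⟧ + outBlocks v 3 B P C 2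
a₀+a₃-pointwise {v} B blockSize indep P ∣P∣≡3 with B P in isBlock
... | true rewrite outBlocks-block 3 B blockSize indep P ∣P∣≡3 isBlock = refl
... | false with outBlocks v 3 B P | outBlocks≤k 3 B blockSize indep P ∣P∣≡3
... | 0 | _ = refl
... | 1 | _ = refl
... | 2 | _ = refl
... | 3 | _ = refl
... | suc (suc (suc (suc _))) | s≤s (s≤s (s≤s ()))

numBlocks≡∑ : {v : ℕ} (k : ℕ) (B : BlockSet v) → BlockSize v k B → numBlocks B ≡ ∑ (kSubsets v k) (λ P → ⟦ B P ⟧)
numBlocks≡∑ {v} k B blockSize =
  trans (count≡∑ B (allSubsets v)) (trans (∑-cong (allSubsets v) onlyKSets) (sym (∑-filter _ (allSubsets v) _)))
  where
  onlyKSets : ∀ P → ⟦ B P ⟧ ≡ ⟦ ∣ P ∣ ≡ᵇ k ⟧ * ⟦ B P ⟧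
  onlyKSets P with B P in isBlock
  ... | false = sym (*-zeroʳ ⟦ ∣ P ∣ ≡ᵇ k ⟧)
  ... | true rewrite ⟦≡ᵇ⟧-refl _ _ (blockSize P isBlock) = refl

-- The basic design identity λ₀ · C(k,t) = λ · C(v,t), by counting flags T ⊆ Q with |T| = t.
numBlocks-identity : {t v k lam : ℕ} (B : BlockSet v) → IsDesign t v k lam B →
  numBlocks B * (k C t) ≡ lam * (v C t)
numBlocks-identity {t} {v} {k} {lam} B design@(blockSize , _) = begin
  numBlocks B * (k C t)
    ≡⟨ trans (cong (_* (k C t)) (count≡∑ B (allSubsets v))) (trans (*-comm _ (k C t)) (sym (∑-*ˡ (allSubsets v) (k C t) _))) ⟩
  ∑ (allSubsets v) (λ Q → (k C t) * ⟦ B Q ⟧)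
    ≡⟨ ∑-cong (allSubsets v) perBlock ⟩
  ∑ (allSubsets v) (λ Q → ⟦ B Q ⟧ * ∑ (allSubsets v) (λ T → ⟦ ∣ T ∣ ≡ᵇ t ⟧ * 1 * ⟦ T ⊆ᵇ Q ⟧))
    ≡⟨ sym (flags B (λ T → ⟦ ∣ T ∣ ≡ᵇ t ⟧ * 1)) ⟩
  ∑ (allSubsets v) (λ T → ⟦ ∣ T ∣ ≡ᵇ t ⟧ * 1 * count (λ Q → B Q ∧ T ⊆ᵇ Q) (allSubsets v))
    ≡⟨ design-flags B design (λ _ → 1) ⟩
  lam * ∑ (allSubsets v) (λ T → ⟦ ∣ T ∣ ≡ᵇ t ⟧ * 1)
    ≡⟨ cong (lam *_) (trans (sym (∑-filter _ (allSubsets v) _)) (count-kSubsets v t)) ⟩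
  lam * (v C t) ∎
  where
  perBlock : ∀ Q → (k C t) * ⟦ B Q ⟧ ≡ ⟦ B Q ⟧ * ∑ (allSubsets v) (λ T → ⟦ ∣ T ∣ ≡ᵇ t ⟧ * 1 * ⟦ T ⊆ᵇ Q ⟧)
  perBlock Q = trans (*-comm (k C t) ⟦ B Q ⟧) (⟦⟧*-cong (B Q) (λ isBlock → sym (begin
    ∑ (allSubsets v) (λ T → ⟦ ∣ T ∣ ≡ᵇ t ⟧ * 1 * ⟦ T ⊆ᵇ Q ⟧)
      ≡⟨ ∑-cong (allSubsets v) (λ T → cong (_* ⟦ T ⊆ᵇ Q ⟧) (*-identityʳ ⟦ ∣ T ∣ ≡ᵇ t ⟧)) ⟩
    subsets Q t    ≡⟨ subsets≡C Q t ⟩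
    ∣ Q ∣ C t      ≡⟨ cong (_C t) (blockSize Q isBlock) ⟩
    k C t          ∎)))

C2-formula : ∀ n → 2 * (suc n C 2) ≡ suc n * n
C2-formula zero = refl
C2-formula (suc m) = begin
  2 * (suc (suc m) C 2)               ≡⟨ cong (2 *_) (sym (nCk+nC[k+1]≡[n+1]C[k+1] (suc m) 1)) ⟩
  2 * (suc m C 1 + suc m C 2)         ≡⟨ cong (λ c → 2 * (c + suc m C 2)) (nC1≡n (suc m)) ⟩
  2 * (suc m + suc m C 2)             ≡⟨ *-distribˡ-+ 2 (suc m) _ ⟩
  2 * suc m + 2 * (suc m C 2)         ≡⟨ cong (2 * suc m +_) (C2-formula m) ⟩
  2 * suc m + suc m * m               ≡⟨ expand m ⟩
  suc (suc m) * suc m                 ∎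
  where
  expand : ∀ m → 2 * suc m + suc m * m ≡ suc (suc m) * suc m
  expand = solve-∀

C3-formula : ∀ n → 6 * (suc (suc n) C 3) ≡ suc (suc n) * suc n * n
C3-formula zero = refl
C3-formula (suc m) = begin
  6 * (suc (suc (suc m)) C 3)                 ≡⟨ cong (6 *_) (sym (nCk+nC[k+1]≡[n+1]C[k+1] (suc (suc m)) 2)) ⟩
  6 * (suc (suc m) C 2 + suc (suc m) C 3)     ≡⟨ *-distribˡ-+ 6 (suc (suc m) C 2) _ ⟩
  6 * (suc (suc m) C 2) + 6 * (suc (suc m) C 3) ≡⟨ cong₂ _+_ (trans (*-assoc 3 2 (suc (suc m) C 2)) (cong (3 *_) (C2-formula (suc m)))) (C3-formula m) ⟩
  3 * (suc (suc m) * suc m) + suc (suc m) * suc m * m ≡⟨ expand m ⟩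
  suc (suc (suc m)) * suc (suc m) * suc m     ∎
  where
  expand : ∀ m → 3 * (suc (suc m) * suc m) + suc (suc m) * suc m * m ≡ suc (suc (suc m)) * suc (suc m) * suc m
  expand = solve-∀

-- The arithmetic of part (2), for v = w + 3, with
--   A = a₀ + a₃,  E = edges from non-blocks into blocks,  N = number of non-blocks,
--   S = Σ I(B,C),  L = λ₀.
-- From 6L = v(v-1) and N + L = C(v,3) one gets N = Lw; with 2E = 3Lw this turns
-- A + E = N + S into 2A + Lw = 2S, i.e. 12A + v(v-1)(v-3) = 12S.
sts-arithmetic : (w A E N S L : ℕ) →
  A + E ≡ N + S → N + L ≡ (3 + w) C 3 → L * (3 C 2) ≡ 1 * ((3 + w) C 2) → 2 * E ≡ L * 3 * w →
  12 * A + (3 + w) * (2 + w) * w ≡ 12 * S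
sts-arithmetic w A E N S L A+E≡N+S N+L≡C3 L-identity 2E≡3Lw = begin
  12 * A + (3 + w) * (2 + w) * w  ≡⟨ cong (λ x → 12 * A + x * w) (sym 6L≡v[v-1]) ⟩
  12 * A + 6 * L * w              ≡⟨ regroup₁ A L w ⟩
  6 * (2 * A + L * w)             ≡⟨ cong (6 *_) 2A+Lw≡2S ⟩
  6 * (2 * S)                     ≡⟨ sym (*-assoc 6 2 S) ⟩
  12 * S                          ∎
  where
  regroup₁ : ∀ A L w → 12 * A + 6 * L * w ≡ 6 * (2 * A + L * w)
  regroup₁ = solve-∀
  regroup₂ : ∀ N L → 6 * N + 6 * L ≡ 6 * (N + L)
  regroup₂ = solve-∀
  regroup₃ : ∀ L w → 6 * L * (1 + w) ≡ 6 * (L * w) + 6 * L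
  regroup₃ = solve-∀
  regroup₄ : ∀ A L w → 2 * A + L * w + 2 * (L * w) ≡ 2 * A + L * 3 * w
  regroup₄ = solve-∀
  regroup₅ : ∀ N S → 2 * (N + S) ≡ 2 * S + 2 * N
  regroup₅ = solve-∀
  6L≡v[v-1] : 6 * L ≡ (3 + w) * (2 + w)
  6L≡v[v-1] = begin
    6 * L               ≡⟨ *-comm 6 L ⟩
    L * 6               ≡⟨ sym (*-assoc L 3 2) ⟩
    L * 3 * 2           ≡⟨ cong (_* 2) (trans L-identity (*-identityˡ _)) ⟩
    ((3 + w) C 2) * 2   ≡⟨ *-comm ((3 + w) C 2) 2 ⟩
    2 * ((3 + w) C 2)   ≡⟨ C2-formula (2 + w) ⟩
    (3 + w) * (2 + w)   ∎
  N≡Lw : N ≡ L * w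
  N≡Lw = *-cancelˡ-≡ N (L * w) 6 (+-cancelʳ-≡ (6 * L) _ _ (begin
    6 * N + 6 * L                  ≡⟨ regroup₂ N L ⟩
    6 * (N + L)                    ≡⟨ cong (6 *_) N+L≡C3 ⟩
    6 * ((3 + w) C 3)              ≡⟨ C3-formula (1 + w) ⟩
    (3 + w) * (2 + w) * (1 + w)    ≡⟨ cong (_* (1 + w)) (sym 6L≡v[v-1]) ⟩
    6 * L * (1 + w)                ≡⟨ regroup₃ L w ⟩
    6 * (L * w) + 6 * L            ∎))
  2A+Lw≡2S : 2 * A + L * w ≡ 2 * S
  2A+Lw≡2S = +-cancelʳ-≡ (2 * (L * w)) _ _ (begin
    2 * A + L * w + 2 * (L * w)    ≡⟨ regroup₄ A L w ⟩
    2 * A + L * 3 * w              ≡⟨ cong (2 * A +_) (sym 2E≡3Lw) ⟩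
    2 * A + 2 * E                  ≡⟨ sym (*-distribˡ-+ 2 A E) ⟩
    2 * (A + E)                    ≡⟨ cong (2 *_) A+E≡N+S ⟩
    2 * (N + S)                    ≡⟨ regroup₅ N S ⟩
    2 * S + 2 * N                  ≡⟨ cong (λ n → 2 * S + 2 * n) N≡Lw ⟩
    2 * S + 2 * (L * w)            ∎)

part2 : {v : ℕ} → 3 ≤ v → (B : BlockSet v) → IsDesign 2 v 3 1 B →
  12 * (a v 3 B 0 + a v 3 B 3) + v * (v ∸ 1) * (v ∸ 3) ≡ 12 * pairSumI v 3 B
part2 {suc (suc (suc w))} (s≤s (s≤s (s≤s _))) B design@(blockSize , _) =
  sts-arithmetic w A E N (pairSumI v 3 B) (numBlocks B) A+E≡N+S N+L≡C3 (numBlocks-identity B design) 2E≡3Lw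
  where
  v = suc (suc (suc w))
  indep = sts-independent B design
  A = a v 3 B 0 + a v 3 B 3
  E = edgesFromNonBlocks v 3 B
  N = ∑ (kSubsets v 3) (λ P → ⟦ not (B P) ⟧)
  A+E≡N+S : A + E ≡ N + pairSumI v 3 B
  A+E≡N+S = begin
    a v 3 B 0 + a v 3 B 3 + E
      ≡⟨ cong (_+ E) (trans (cong₂ _+_ (count≡∑ _ (kSubsets v 3)) (count≡∑ _ (kSubsets v 3))) (sym (∑-+ (kSubsets v 3) _ _))) ⟩
    ∑ (kSubsets v 3) (λ P → ⟦ not (B P) ∧ (outBlocks v 3 B P ≡ᵇ 0) ⟧ + ⟦ not (B P) ∧ (outBlocks v 3 B P ≡ᵇ 3) ⟧) + E
      ≡⟨ sym (∑-+ (kSubsets v 3) _ _) ⟩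
    ∑ (kSubsets v 3) (λ P → ⟦ not (B P) ∧ (outBlocks v 3 B P ≡ᵇ 0) ⟧ + ⟦ not (B P) ∧ (outBlocks v 3 B P ≡ᵇ 3) ⟧
                             + ⟦ not (B P) ⟧ * outBlocks v 3 B P)
      ≡⟨ ∑-kSubsets-cong 3 (a₀+a₃-pointwise B blockSize indep) ⟩
    ∑ (kSubsets v 3) (λ P → ⟦ not (B P) ⟧ + outBlocks v 3 B P C 2)
      ≡⟨ ∑-+ (kSubsets v 3) _ _ ⟩
    N + ∑ (kSubsets v 3) (λ P → outBlocks v 3 B P C 2)
      ≡⟨ cong (N +_) (sym (pairSumI≡∑C2 3 B blockSize)) ⟩
    N + pairSumI v 3 B ∎
  N+L≡C3 : N + numBlocks B ≡ v C 3
  N+L≡C3 = begin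
    N + numBlocks B                                      ≡⟨ cong (N +_) (numBlocks≡∑ 3 B blockSize) ⟩
    N + ∑ (kSubsets v 3) (λ P → ⟦ B P ⟧)                  ≡⟨ sym (∑-+ (kSubsets v 3) _ _) ⟩
    ∑ (kSubsets v 3) (λ P → ⟦ not (B P) ⟧ + ⟦ B P ⟧)      ≡⟨ ∑-cong (kSubsets v 3) (λ P → ⟦not⟧ (B P)) ⟩
    ∑ (kSubsets v 3) (λ _ → 1)                           ≡⟨ count-kSubsets v 3 ⟩
    v C 3                                                ∎
  2E≡3Lw : 2 * E ≡ numBlocks B * 3 * w
  2E≡3Lw = trans (cong (2 *_) (edgesFromNonBlocks≡edgesIntoBlocks 3 B blockSize indep))
                 (twice-edgesIntoBlocks B (s≤s z≤n) (s≤s (s≤s z≤n)) design)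

lemma6p2 : (t k v lam : ℕ) → t ≤ k → k ≤ v → 1 ≤ lam →
    (B : BlockSet v) → IsDesign t v k lam B →
    ((1 ≤ t → Independent v k B →
        2 * weightedSum v k B ≡ numBlocks B * k * (v ∸ k))
    × (t ≡ 2 → k ≡ 3 → lam ≡ 1 →
        12 * (a v k B 0 + a v k B 3) + v * (v ∸ 1) * (v ∸ 3) ≡ 12 * pairSumI v k B))
lemma6p2 t k v lam t≤k k≤v _ B design =
  (λ 1≤t indep → part1 B 1≤t t≤k design indep) , steiner k≤v design
  where
  steiner : ∀ {t k lam} → k ≤ v → IsDesign t v k lam B → t ≡ 2 → k ≡ 3 → lam ≡ 1 →
    12 * (a v k B 0 + a v k B 3) + v * (v ∸ 1) * (v ∸ 3) ≡ 12 * pairSumI v k B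
  steiner 3≤v sts refl refl refl = part2 3≤v B sts
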